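{- Let $(\mathbf{H},\varphi)$ be a linearized combinatorial Hopf monoid such that $\varphi$ is a balanced convex character, let $N$ be a finite set, $\mathbf{h}\in\mathbf{H}[N]$, and $\mathfrak{G}\subseteq\mathrm{Aut}(\mathbf{h})$. Then $\mathfrak{G}\subseteq\mathrm{Aut}(\Sigma_\varphi(\mathbf{h}))$ (for the action of $\mathfrak{G}$ on subsets of $N$), and $$\Psi_{\mathbf{H},\varphi}(\mathbf{h},\mathfrak{G},\mathbf{x})=F(\Sigma_\varphi(\mathbf{h}),\mathfrak{G},\mathbf{x}).$$
   Context: $\mathbb{N}=\{0,1,2,\dots\}$. A set species $\mathbf{H}$ assigns to each finite set $N$ a finite set $\mathbf{H}[N]$ and to each bijection $\sigma$ a bijection $\mathbf{H}[\sigma]$, functorially. A linearized Hopf monoid: a set species with $|\mathbf{H}[\emptyset]|=1$ and maps $\mu_{M,N}:\mathbf{H}[M]\times\mathbf{H}[N]\to\mathbf{H}[M\sqcup N]$ and $\Delta_{M,N}:\mathbf{H}[M\sqcup N]\to(\mathbf{H}[M]\times\mathbf{H}[N])\sqcup\{0\}$ (write $\Delta_{M,N}(\mathbf{h})=(\mathbf{h}|_M,\mathbf{h}/M)$ when nonzero) for disjoint finite $M,N$, whose linear extensions make the linearization a connected Hopf monoid in linear species. A linearized character: maps $\varphi_N:\mathbf{H}[N]\to\{0,1\}$ natural in bijections and multiplicative, $\varphi(x\cdot y)=\varphi(x)\varphi(y)$. It is balanced convex if for all $\mathbf{h}\in\mathbf{H}[N]$: $|N|=1\Rightarrow\varphi(\mathbf{h})=1$;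 if $|N|>1$ some nonempty $S\subsetneq N$ has $\Delta_{S,N\setminus S}(\mathbf{h})\ne0$; and if $\varphi(\mathbf{h})=1$ and $\Delta_{S,N\setminus S}(\mathbf{h})\ne0$ then $\varphi(\mathbf{h}|_S)=\varphi(\mathbf{h}/S)=1$. For a set composition $C=C_1|\cdots|C_k\models N$, $\Delta_C(\mathbf{h})$ is $\mathbf{h}$ if $k=1$, otherwise $0$ if $\Delta_{C_1,N\setminus C_1}(\mathbf{h})=0$, else $(\mathbf{h}|_{C_1},\Delta_{C_2|\cdots|C_k}(\mathbf{h}/C_1))$; $\varphi_C(\mathbf{h})=\prod\varphi(\mathbf{h}_i)$ if $\Delta_C(\mathbf{h})=(\mathbf{h}_1,\dots,\mathbf{h}_k)$, else $0$. For $f:N\to\mathbb{N}$ with values $i_1<\dots<i_k$, $C(f)=f^{ -1}(i_1)|\cdots|f^{ -1}(i_k)$, and $f$ is $\varphi$-proper iff $\varphi_{C(f)}(\mathbf{h})=1$. $\mathfrak{S}_N$ acts on $\mathbf{H}[N]$ via $\mathbf{H}[\mathfrak{g}]$; $\mathrm{Aut}(\mathbf{h})$ is the stabilizer; $\mathfrak{g}f=f\circ\mathfrak{g}^{ -1}$. $\Psi_{\mathbf{H},\varphi}(\mathbf{h},\mathfrak{G},\mathbf{x};\mathfrak{g})=\sum_{f\ \varphi\text{ -proper},\ \mathfrak{g}f=f}\prod_{v\in N}x_{f(v)}$. Coloring complex: vertices are the nonempty proper subsets of $N$ with $\kappa(S)=|S|$; faces are flags $F_\bullet=\{F_1\subset\cdots\subset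 F_k\}$ (strict chains of nonempty proper subsets, including the empty flag); the associated set composition is $C(F_\bullet)=F_1|F_2\setminus F_1|\cdots|F_k\setminus F_{k-1}|N\setminus F_k$ ($C=N$ for the empty flag); and $\Sigma_\varphi(\mathbf{h})=\{F_\bullet:\varphi_{C(F_\bullet)}(\mathbf{h})=1\}$. $\mathfrak{S}_N$ acts on flags by $\mathfrak{g}F_\bullet=\{\mathfrak{g}F_1\subset\cdots\subset\mathfrak{g}F_k\}$. An automorphism of a collection $\Phi$ of such flags is a bijection of vertices preserving $\kappa$ and mapping faces of $\Phi$ to faces of $\Phi$. For $S=\{s_1<\dots<s_k\}\subseteq[|N|-1]$, $\alpha(S)=(s_1,s_2-s_1,\dots,|N|-s_k)$, and $F(\Phi,\mathfrak{G},\mathbf{x};\mathfrak{g})=\sum_{F_\bullet\in\Phi:\ \mathfrak{g}F_\bullet=F_\bullet}M_{\alpha(\kappa(F_\bullet))}$, with $M_\alpha$ the monomial quasisymmetric function. The equality is of functions of $\mathfrak{g}\in\mathfrak{G}$. -}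

module Defs where

open import Data.Nat using (ℕ; zero; suc; _∸_; _⊔_; _<_; _≡ᵇ_; _<ᵇ_)
open import Data.Nat.Properties using () renaming (_≟_ to _≟ℕ_)
open import Data.Bool using (Bool; true; false; not; _∧_; T; if_then_else_)
open import Data.Bool.Properties using (T-irrelevant)
open import Data.Unit using (tt)
open import Data.Fin using (Fin; zero; suc; toℕ)
open import Data.Fin.Subset using (Subset; ∣_∣; _⊂_; _─_; ∁; ⊤)
open import Data.Fin.Subset.Properties using (_⊂?_)
open import Data.Vec using (Vec; []; _∷_; lookup; tabulate; toList)
open import Data.Vec.Properties using () renaming (≡-dec to ≡-decVec)
open import Data.List using (List; []; _∷_; map; length; filterᵇ; upTo; allFin; concatMap; foldr)
open import Data.List.Properties using () renaming (≡-dec to ≡-decList)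
open import Data.List.Relation.Binary.Permutation.Propositional using (_↭_)
open import Data.Bool.ListAction using (all; any)
open import Data.Maybe using (Maybe; just; nothing; maybe′; _>>=_)
import Data.Maybe as Maybe
open import Data.Product using (Σ; _×_; _,_; proj₁; proj₂; ∃)
import Data.Product as Prod
open import Data.Sum using (_⊎_; inj₁; inj₂; [_,_]′)
import Data.Sum as Sum
open import Data.Product.Function.Dependent.Propositional using (Σ-↔)
open import Function using (_∘_; id)
open import Function.Bundles using (_↔_; Inverse; mk↔ₛ′)
open import Function.Construct.Composition using (_↔-∘_)
open import Relation.Binary.PropositionalEquality using (_≡_; _≢_; refl; sym; trans; cong; subst)
open import Relation.Nullary.Decidable using (⌊_⌋)
open import Data.Empty using (⊥-elim)

open Inverse

record FinSet : Set₁ where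
  constructor mkFinSet
  field
    Carrier : Set
    size    : ℕ
    enum    : Carrier ↔ Fin size

open FinSet public

record Bij (A B : FinSet) : Set where
  constructor bij
  field
    iso : Carrier A ↔ Carrier B

record Decomp (I M N : FinSet) : Set where
  constructor decomp
  field
    iso : Carrier I ↔ (Carrier M ⊎ Carrier N)

⇑ : {A B : FinSet} → Bij A B → Carrier A → Carrier B
⇑ σ = to (Bij.iso σ)

⇓ : {A B : FinSet} → Bij A B → Carrier B → Carrier A
⇓ σ = from (Bij.iso σ)

⇑d : {I M N : FinSet} → Decomp I M N → Carrier I → Carrier M ⊎ Carrier N
⇑d e = to (Decomp.iso e)

countF : ∀ {n} → (Fin n → Bool) → ℕ
countF {zero}  Q = 0
countF {suc n} Q = if Q zero then suc (countF (Q ∘ suc)) else countF (Q ∘ suc)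

private
  subFinAux : ∀ {n} (Q : Fin (suc n) → Bool) (b : Bool) → Q zero ≡ b →
              Σ (Fin n) (T ∘ Q ∘ suc) ↔ Fin (countF (Q ∘ suc)) →
              Σ (Fin (suc n)) (T ∘ Q) ↔ Fin (if b then suc (countF (Q ∘ suc)) else countF (Q ∘ suc))
  subFinAux Q true eq r = mk↔ₛ′ t f invˡ invʳ
    where
    t : Σ _ (T ∘ Q) → Fin (suc (countF (Q ∘ suc)))
    t (zero  , p) = zero
    t (suc i , p) = suc (to r (i , p))
    f : Fin (suc (countF (Q ∘ suc))) → Σ _ (T ∘ Q)
    f zero    = zero , subst T (sym eq) tt
    f (suc j) = suc (proj₁ (from r j)) , proj₂ (from r j)
    invˡ : ∀ y → t (f y) ≡ y
    invˡ zero    = refl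
    invˡ (suc j) = cong suc (strictlyInverseˡ r j)
    invʳ : ∀ x → f (t x) ≡ x
    invʳ (zero  , p) = cong (zero ,_) (T-irrelevant _ _)
    invʳ (suc i , p) = cong (λ z → suc (proj₁ z) , proj₂ z) (strictlyInverseʳ r (i , p))
  subFinAux Q false eq r = mk↔ₛ′ t f invˡ invʳ
    where
    t : Σ _ (T ∘ Q) → Fin (countF (Q ∘ suc))
    t (zero  , p) = ⊥-elim (subst T eq p)
    t (suc i , p) = to r (i , p)
    f : Fin (countF (Q ∘ suc)) → Σ _ (T ∘ Q)
    f j = suc (proj₁ (from r j)) , proj₂ (from r j)
    invˡ : ∀ y → t (f y) ≡ y
    invˡ j = strictlyInverseˡ r j
    invʳ : ∀ x → f (t x) ≡ x
    invʳ (zero  , p) = ⊥-elim (subst T eq p)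
    invʳ (suc i , p) = cong (λ z → suc (proj₁ z) , proj₂ z) (strictlyInverseʳ r (i , p))

subFin : ∀ {n} (Q : Fin n → Bool) → Σ (Fin n) (T ∘ Q) ↔ Fin (countF Q)
subFin {zero}  Q = mk↔ₛ′ (λ { (() , _) }) (λ ()) (λ ()) (λ { (() , _) })
subFin {suc n} Q = subFinAux Q (Q zero) refl (subFin (Q ∘ suc))

private
  T↔ : ∀ {a b : Bool} → a ≡ b → T a ↔ T b
  T↔ eq = mk↔ₛ′ (subst T eq) (subst T (sym eq)) (λ _ → T-irrelevant _ _) (λ _ → T-irrelevant _ _)

_∣_ : (A : FinSet) → (Carrier A → Bool) → FinSet
A ∣ P = record
  { Carrier = Σ (Carrier A) (T ∘ P)
  ; size    = countF (P ∘ from (enum A))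
  ; enum    = subFin (P ∘ from (enum A))
              ↔-∘ Σ-↔ (enum A) (λ {a} → T↔ (sym (cong P (strictlyInverseʳ (enum A) a))))
  }

private
  splitTo : (A : FinSet) (P : Carrier A → Bool) (a : Carrier A) (b : Bool) → P a ≡ b →
            Carrier (A ∣ P) ⊎ Carrier (A ∣ (not ∘ P))
  splitTo A P a true  eq = inj₁ (a , subst T (sym eq) tt)
  splitTo A P a false eq = inj₂ (a , subst T (sym (cong not eq)) tt)

  splitFrom : (A : FinSet) (P : Carrier A → Bool) →
              Carrier (A ∣ P) ⊎ Carrier (A ∣ (not ∘ P)) → Carrier A
  splitFrom A P = [ proj₁ , proj₁ ]′

  split-invʳ : (A : FinSet) (P : Carrier A → Bool) (a : Carrier A) (b : Bool) (eq : P a ≡ b) →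
               splitFrom A P (splitTo A P a b eq) ≡ a
  split-invʳ A P a true  eq = refl
  split-invʳ A P a false eq = refl

  split-invˡ₁ : (A : FinSet) (P : Carrier A → Bool) (a : Carrier A) (p : T (P a)) (b : Bool) (eq : P a ≡ b) →
                splitTo A P a b eq ≡ inj₁ (a , p)
  split-invˡ₁ A P a p true  eq = cong (λ z → inj₁ (a , z)) (T-irrelevant _ _)
  split-invˡ₁ A P a p false eq = ⊥-elim (subst T eq p)

  split-invˡ₂ : (A : FinSet) (P : Carrier A → Bool) (a : Carrier A) (p : T (not (P a))) (b : Bool) (eq : P a ≡ b) →
                splitTo A P a b eq ≡ inj₂ (a , p)
  split-invˡ₂ A P a p true  eq = ⊥-elim (subst T (cong not eq) p)
  split-invˡ₂ A P a p false eq = cong (λ z → inj₂ (a , z)) (T-irrelevant _ _)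

split : (A : FinSet) (P : Carrier A → Bool) → Decomp A (A ∣ P) (A ∣ (not ∘ P))
split A P = decomp (mk↔ₛ′ (λ a → splitTo A P a (P a) refl) (splitFrom A P) invˡ (λ a → split-invʳ A P a (P a) refl))
  where
  invˡ : ∀ y → splitTo A P (splitFrom A P y) (P (splitFrom A P y)) refl ≡ y
  invˡ (inj₁ (a , p)) = split-invˡ₁ A P a p (P a) refl
  invˡ (inj₂ (a , p)) = split-invˡ₂ A P a p (P a) refl

-- Set species (functors from finite sets and bijections to finite sets).
-- Functoriality is stated pointwise (no function extensionality).

record Species : Set₂ where
  field
    H        : FinSet → Set
    H-finite : (A : FinSet) → Σ ℕ (λ m → H A ↔ Fin m)
    Hmap     : {A B : FinSet} → Bij A B → H A → H B
    Hmap-id  : {A : FinSet} (σ : Bij A A) → (∀ a → ⇑ σ a ≡ a) → ∀ x → Hmap σ x ≡ x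
    Hmap-∘   : {A B C : FinSet} (σ : Bij A B) (τ : Bij B C) (ρ : Bij A C) →
               (∀ a → ⇑ ρ a ≡ ⇑ τ (⇑ σ a)) → ∀ x → Hmap ρ x ≡ Hmap τ (Hmap σ x)

-- Products and coproducts are indexed
-- by decompositions I ≅ M ⊔ N (Day-convolution form); naturality makes
-- this the same as indexing by pairs of disjoint subsets.  Δ returns
-- 'nothing' for the value 0.

assocL : {I J A B C : FinSet} → (Decomp I J C) → (Decomp J A B) →
         Carrier I → Carrier A ⊎ (Carrier B ⊎ Carrier C)
assocL e₁ e₂ i = [ (λ j → [ inj₁ , (inj₂ ∘ inj₁) ]′ (⇑d e₂ j)) , (inj₂ ∘ inj₂) ]′ (⇑d e₁ i)

assocR : {I K A B C : FinSet} → (Decomp I A K) → (Decomp K B C) →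
         Carrier I → Carrier A ⊎ (Carrier B ⊎ Carrier C)
assocR e₃ e₄ i = [ inj₁ , (λ k → inj₂ (⇑d e₄ k)) ]′ (⇑d e₃ i)

-- four-way decomposition I ≅ (A∩S ⊔ A∩T) ⊔ (B∩S ⊔ B∩T), from the (A,B) side and from the (S,T) side
fourAB : {I A B P Q R U : FinSet} → (Decomp I A B) →
         (Decomp A P Q) → (Decomp B R U) →
         Carrier I → (Carrier P ⊎ Carrier Q) ⊎ (Carrier R ⊎ Carrier U)
fourAB e eA eB i = Sum.map (⇑d eA) (⇑d eB) (⇑d e i)

fourST : {I S T' P Q R U : FinSet} → (Decomp I S T') →
         (Decomp S P R) → (Decomp T' Q U) →
         Carrier I → (Carrier P ⊎ Carrier Q) ⊎ (Carrier R ⊎ Carrier U)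
fourST f eS eT i =
  [ (λ s → [ (inj₁ ∘ inj₁) , (inj₂ ∘ inj₁) ]′ (⇑d eS s))
  , (λ t → [ (inj₁ ∘ inj₂) , (inj₂ ∘ inj₂) ]′ (⇑d eT t)) ]′ (⇑d f i)

record LinHopf : Set₂ where
  field
    species : Species
  open Species species public
  field
    H-empty : (E : FinSet) → size E ≡ 0 → Σ (H E) (λ u → ∀ x → x ≡ u)
    μ : {I M N : FinSet} → (Decomp I M N) → H M → H N → H I
    Δ : {I M N : FinSet} → (Decomp I M N) → H I → Maybe (H M × H N)
    μ-nat : {I M N I' M' N' : FinSet}
            (e : Decomp I M N) (e' : Decomp I' M' N')
            (α : Bij M M') (β : Bij N N') (γ : Bij I I') →
            (∀ i → ⇑d e' (⇑ γ i) ≡ Sum.map (⇑ α) (⇑ β) (⇑d e i)) →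
            ∀ a b → μ e' (Hmap α a) (Hmap β b) ≡ Hmap γ (μ e a b)
    Δ-nat : {I M N I' M' N' : FinSet}
            (e : Decomp I M N) (e' : Decomp I' M' N')
            (α : Bij M M') (β : Bij N N') (γ : Bij I I') →
            (∀ i → ⇑d e' (⇑ γ i) ≡ Sum.map (⇑ α) (⇑ β) (⇑d e i)) →
            ∀ x → Δ e' (Hmap γ x) ≡ Maybe.map (Prod.map (Hmap α) (Hmap β)) (Δ e x)
    μ-assoc : {I J K A B C : FinSet}
              (e₁ : Decomp I J C) (e₂ : Decomp J A B)
              (e₃ : Decomp I A K) (e₄ : Decomp K B C) →
              (∀ i → assocL {I} {J} {A} {B} {C} e₁ e₂ i ≡ assocR {I} {K} {A} {B} {C} e₃ e₄ i) →
              ∀ a b c → μ e₁ (μ e₂ a b) c ≡ μ e₃ a (μ e₄ b c)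
    Δ-coassoc : {I J K A B C : FinSet}
              (e₁ : Decomp I J C) (e₂ : Decomp J A B)
              (e₃ : Decomp I A K) (e₄ : Decomp K B C) →
              (∀ i → assocL {I} {J} {A} {B} {C} e₁ e₂ i ≡ assocR {I} {K} {A} {B} {C} e₃ e₄ i) →
              ∀ x → (Δ e₁ x >>= λ jc → Δ e₂ (proj₁ jc) >>= λ ab → just (proj₁ ab , proj₂ ab , proj₂ jc))
                  ≡ (Δ e₃ x >>= λ ak → Δ e₄ (proj₂ ak) >>= λ bc → just (proj₁ ak , proj₁ bc , proj₂ bc))
    μ-unitˡ : {I E M : FinSet} → size E ≡ 0 →
              (e : Decomp I E M) (γ : Bij M I) →
              (∀ m → ⇑d e (⇑ γ m) ≡ inj₂ m) → ∀ u m → μ e u m ≡ Hmap γ m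
    μ-unitʳ : {I M E : FinSet} → size E ≡ 0 →
              (e : Decomp I M E) (γ : Bij M I) →
              (∀ m → ⇑d e (⇑ γ m) ≡ inj₁ m) → ∀ m u → μ e m u ≡ Hmap γ m
    Δ-counitˡ : {I E M : FinSet} → size E ≡ 0 →
              (e : Decomp I E M) (γ : Bij I M) →
              (∀ i → ⇑d e i ≡ inj₂ (⇑ γ i)) → ∀ x → Maybe.map proj₂ (Δ e x) ≡ just (Hmap γ x)
    Δ-counitʳ : {I M E : FinSet} → size E ≡ 0 →
              (e : Decomp I M E) (γ : Bij I M) →
              (∀ i → ⇑d e i ≡ inj₁ (⇑ γ i)) → ∀ x → Maybe.map proj₁ (Δ e x) ≡ just (Hmap γ x)
    compat : {I A B S T' P Q R U : FinSet}
             (e : Decomp I A B) (f : Decomp I S T')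
             (eA : Decomp A P Q) (eB : Decomp B R U)
             (eS : Decomp S P R) (eT : Decomp T' Q U) →
             (∀ i → fourAB {I} {A} {B} {P} {Q} {R} {U} e eA eB i ≡ fourST {I} {S} {T'} {P} {Q} {R} {U} f eS eT i) →
             ∀ a b → Δ f (μ e a b)
                   ≡ (Δ eA a >>= λ pq → Δ eB b >>= λ ru →
                        just (μ eS (proj₁ pq) (proj₁ ru) , μ eT (proj₂ pq) (proj₂ ru)))

-- Linearized characters (values 0,1 encoded as false,true).

record Character (Hp : LinHopf) : Set₁ where
  open LinHopf Hp
  field
    φ      : {A : FinSet} → H A → Bool
    φ-nat  : {A B : FinSet} (σ : Bij A B) (x : H A) → φ (Hmap σ x) ≡ φ x
    φ-mult : {I M N : FinSet} (e : Decomp I M N) (a : H M) (b : H N) →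
             φ (μ e a b) ≡ (φ a ∧ φ b)
    φ-unit : (E : FinSet) → size E ≡ 0 → (u : H E) → φ u ≡ true

record BalancedConvex (Hp : LinHopf) (χ : Character Hp) : Set₁ where
  open LinHopf Hp
  open Character χ
  field
    bc-single : (A : FinSet) → size A ≡ 1 → (h : H A) → φ h ≡ true
    bc-split  : (A : FinSet) → 1 < size A → (h : H A) →
                Σ (Carrier A → Bool) λ P →
                  Σ (Carrier A) (T ∘ P) × Σ (Carrier A) (T ∘ not ∘ P) ×
                  (Δ (split A P) h ≢ nothing)
    bc-convex : (A : FinSet) (h : H A) (P : Carrier A → Bool) (x : H (A ∣ P)) (y : H (A ∣ (not ∘ P))) →
                φ h ≡ true → Δ (split A P) h ≡ just (x , y) → (φ x ≡ true) × (φ y ≡ true)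

countᵇ : {A : Set} → (A → Bool) → List A → ℕ
countᵇ p xs = length (filterᵇ p xs)

allVecs : {A : Set} → List A → (n : ℕ) → List (Vec A n)
allVecs xs zero    = [] ∷ []
allVecs xs (suc n) = concatMap (λ x → map (x ∷_) (allVecs xs n)) xs

allSubsets : (n : ℕ) → List (Subset n)
allSubsets n = allVecs (true ∷ false ∷ []) n

allSubsetLists : (n : ℕ) → List (List (Subset n))
allSubsetLists n = concatMap (λ l → map toList (allVecs (allSubsets n) l)) (upTo (suc n))

_==ℕs_ : List ℕ → List ℕ → Bool
xs ==ℕs ys = ⌊ ≡-decList _≟ℕ_ xs ys ⌋

_==Ss_ : ∀ {n} → List (Subset n) → List (Subset n) → Bool
xs ==Ss ys = ⌊ ≡-decList (≡-decVec Data.Bool._≟_) xs ys ⌋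
  where import Data.Bool

nonzeros : ∀ {K} → (Fin K → ℕ) → List ℕ
nonzeros {K} e = filterᵇ (λ k → 0 <ᵇ k) (map e (allFin K))

module Theory (Hp : LinHopf) (χ : Character Hp) where
  open LinHopf Hp
  open Character χ

  -- Δ_C for a set composition given as the ordered list of its blocks,
  -- each block a predicate on an ambient type X into which A embeds via ι.
  ΔC⁺ : {X : Set} (A : FinSet) → (Carrier A → X) → (X → Bool) → List (X → Bool) → H A →
        Maybe (List (Σ FinSet H))
  ΔC⁺ A ι B []        h = just ((A , h) ∷ [])
  ΔC⁺ A ι B (B' ∷ Bs) h =
    maybe′ (λ xy → Maybe.map ((A ∣ (B ∘ ι) , proj₁ xy) ∷_)
                             (ΔC⁺ (A ∣ (not ∘ B ∘ ι)) (ι ∘ proj₁) B' Bs (proj₂ xy)))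
           nothing
           (Δ (split A (B ∘ ι)) h)

  ΔC : {X : Set} (A : FinSet) → (Carrier A → X) → List (X → Bool) → H A → Maybe (List (Σ FinSet H))
  ΔC A ι []       h = just []
  ΔC A ι (B ∷ Bs) h = ΔC⁺ A ι B Bs h

  φC : (N : FinSet) → List (Carrier N → Bool) → H N → Bool
  φC N C h = maybe′ (all (λ p → φ (proj₂ p))) false (ΔC N id C h)

  module OnSet (N : FinSet) (h : H N) where
    n : ℕ
    n = size N

    elt : Fin n → Carrier N
    elt = from (enum N)

    -- the predicate on N of a subset of N (subsets of N coded via enum N)
    ⟪_⟫ : Subset n → Carrier N → Bool
    ⟪ S ⟫ v = lookup S (to (enum N) v)

    -- C(f) = f⁻¹(i₁) | ⋯ | f⁻¹(i_k) for the values i₁ < ⋯ < i_k of f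
    values : (Carrier N → ℕ) → List ℕ
    values f = filterᵇ (λ i → any (λ j → f (elt j) ≡ᵇ i) (allFin n))
                       (upTo (suc (foldr _⊔_ 0 (map (f ∘ elt) (allFin n)))))

    Cf : (Carrier N → ℕ) → List (Carrier N → Bool)
    Cf f = map (λ i v → f v ≡ᵇ i) (values f)

    properᵇ : (Carrier N → ℕ) → Bool
    properᵇ f = φC N (Cf f) h

    fixedFunᵇ : Bij N N → (Carrier N → ℕ) → Bool
    fixedFunᵇ g f = all (λ j → f (⇓ g (elt j)) ≡ᵇ f (elt j)) (allFin n)

    fiber : (Carrier N → ℕ) → ℕ → ℕ
    fiber f i = countᵇ (λ j → f (elt j) ≡ᵇ i) (allFin n)

    -- coefficient of x^e = ∏_{i<K} x_i^{e i} in Ψ_{H,φ}(h,𝔊,x;𝔤):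
    -- the number of φ-proper, 𝔤-fixed f : N → ℕ with ∏_v x_{f v} = x^e,
    -- i.e. f takes values < K and |f⁻¹(i)| = e i.
    Ψcoef : Bij N N → (K : ℕ) → (Fin K → ℕ) → ℕ
    Ψcoef g K e = countᵇ cond (allVecs (allFin K) n)
      where
      cond : Vec (Fin K) n → Bool
      cond w = let f = λ v → toℕ (lookup w (to (enum N) v)) in
               properᵇ f ∧ fixedFunᵇ g f ∧ all (λ i → fiber f (toℕ i) ≡ᵇ e i) (allFin K)

    Vertexᵇ : Subset n → Bool
    Vertexᵇ S = (0 <ᵇ ∣ S ∣) ∧ (∣ S ∣ <ᵇ n)

    Vertex : Subset n → Set
    Vertex S = T (Vertexᵇ S)

    chainᵇ : List (Subset n) → Bool
    chainᵇ []             = true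
    chainᵇ (S ∷ [])       = true
    chainᵇ (S ∷ S' ∷ Ss)  = ⌊ S ⊂? S' ⌋ ∧ chainᵇ (S' ∷ Ss)

    IsFlagᵇ : List (Subset n) → Bool
    IsFlagᵇ F = all Vertexᵇ F ∧ chainᵇ F

    compOf : List (Subset n) → List (Subset n)
    compOf []       = ⊤ ∷ []
    compOf (F ∷ Fs) = F ∷ go F Fs
      where
      go : Subset n → List (Subset n) → List (Subset n)
      go prev []       = ∁ prev ∷ []
      go prev (G ∷ Gs) = (G ─ prev) ∷ go G Gs

    inΣᵇ : List (Subset n) → Bool
    inΣᵇ F = φC N (map ⟪_⟫ (compOf F)) h

    Σφ : List (Subset n) → Set
    Σφ F = T (IsFlagᵇ F) × T (inΣᵇ F)

    actSub : Bij N N → Subset n → Subset n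
    actSub g S = tabulate (λ j → ⟪ S ⟫ (⇓ g (elt j)))

    -- automorphism of a collection Φ of flags: a bijection ψ of the vertex set
    -- preserving κ = |·| and mapping faces of Φ to faces of Φ (faces as sets of vertices)
    IsAut : (List (Subset n) → Set) → (Subset n → Subset n) → Set
    IsAut Φ ψ =
      (∀ S → Vertex S → Vertex (ψ S)) ×
      (∀ S → Vertex S → ∣ ψ S ∣ ≡ ∣ S ∣) ×
      (∀ S S' → Vertex S → Vertex S' → ψ S ≡ ψ S' → S ≡ S') ×
      (∀ S' → Vertex S' → Σ (Subset n) λ S → Vertex S × ψ S ≡ S') ×
      (∀ F → Φ F → Σ (List (Subset n)) λ F' → Φ F' × (map ψ F ↭ F'))

    -- α(κ(F•)) = (s₁, s₂-s₁, …, |N|-s_k); zero parts (only possible when N = ∅) dropped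
    alpha : List (Subset n) → List ℕ
    alpha F = filterᵇ (λ k → 0 <ᵇ k) (go 0 (map ∣_∣ F))
      where
      go : ℕ → List ℕ → List ℕ
      go prev []       = (n ∸ prev) ∷ []
      go prev (s ∷ ss) = (s ∸ prev) ∷ go s ss

    -- coefficient of x^e in M_α: 1 iff the nonzero exponents of e, in order, are α
    -- coefficient of x^e in F(Σ_φ(h),𝔊,x;𝔤) = Σ_{F• ∈ Σ_φ(h), 𝔤F• = F•} M_{α(κ(F•))}
    Fcoef : Bij N N → (K : ℕ) → (Fin K → ℕ) → ℕ
    Fcoef g K e = countᵇ cond (allSubsetLists n)
      where
      cond : List (Subset n) → Bool
      cond F = IsFlagᵇ F ∧ inΣᵇ F ∧ (map (actSub g) F ==Ss F) ∧ (nonzeros e ==ℕs alpha F)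

-- Since 𝔤 fixes h and Δ, φ are natural, transporting along 𝔤 gives φ_C(h) = φ_{𝔤C}(h) for every set
-- composition C; as 𝔤 permutes subsets preserving size and strict inclusion, it is an automorphism of
-- Σ_φ(h). For the coefficient of x^e, let c₁ < ⋯ < c_k be the colors with e cᵢ > 0. A coloring f
-- with fibers of sizes e determines the flag of sublevel sets {f ≤ c₁} ⊂ ⋯ ⊂ {f ≤ c_{k-1}}, and f is
-- recovered from it; C(f) is the set composition of this flag, so f is φ-proper iff the flag lies in
-- Σ_φ(h), f is 𝔤-fixed iff the flag is, and the flag has α(κ(F•)) = (e c₁, …, e c_k), i.e. M_α has
-- coefficient 1 at x^e. Every such flag arises this way, so the two coefficients count the same set.

module Submission where

open import Data.Bool using (Bool; true; false; not; _∧_; T; if_then_else_)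
open import Data.Bool.ListAction using (all; any)
open import Data.Bool.Properties using (T-≡; T-∧; T-irrelevant; ∧-zeroʳ; ∧-identityʳ)
open import Data.Empty using (⊥; ⊥-elim)
open import Data.Fin using (Fin; toℕ)
import Data.Fin as Fin
open import Data.Fin.Permutation using (Permutation′; _⟨$⟩ʳ_; _⟨$⟩ˡ_; inverseˡ; inverseʳ; flip)
open import Data.Fin.Properties using (toℕ-injective; toℕ<n; ¬Fin0)
open import Data.Fin.Subset using (Subset; ∣_∣; _⊂_; _⊆_; ∁; ⊤; _─_) renaming (_∈_ to _∈ₛ_; _∉_ to _∉ₛ_)
open import Data.Fin.Subset.Properties using (_⊂?_; p⊂q⇒∣p∣<∣q∣)
open import Data.List using (List; []; _∷_; _++_; length; map; filterᵇ; concatMap; upTo; allFin; foldr; applyUpTo; iterate)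
import Data.List as List
open import Data.List.Properties
  using (length-++; length-map; length-iterate; map-∘; map-tabulate; map-upTo; upTo-∷ʳ; ∷-injectiveˡ; ∷-injectiveʳ;
         filter-++; filter-all; filter-none; ++-identityʳ)
open import Data.List.Membership.Propositional using (_∈_; lose; find)
open import Data.List.Membership.Propositional.Properties
  using (∈-∃++; ∈-filter⁺; ∈-filter⁻; ∈-map⁺; ∈-map⁻; ∈-concatMap⁺; ∈-concatMap⁻; ∈-upTo⁺; ∈-allFin)
open import Data.List.Relation.Binary.Permutation.Propositional using (↭-refl)
open import Data.List.Relation.Binary.Pointwise using (Pointwise; []; _∷_; Pointwise-≡⇒≡)
open import Data.List.Relation.Unary.All using (All; []; _∷_)
import Data.List.Relation.Unary.All as All
import Data.List.Relation.Unary.All.Properties as All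
open import Data.List.Relation.Unary.AllPairs using (AllPairs; []; _∷_)
import Data.List.Relation.Unary.AllPairs.Properties as AllPairs
open import Data.List.Relation.Unary.Any using (here; there)
open import Data.List.Relation.Unary.Linked using (Linked; []; [-]; _∷_)
import Data.List.Relation.Unary.Linked as Linked
open import Data.List.Relation.Unary.Unique.Propositional using (Unique)
import Data.List.Relation.Unary.Unique.Propositional.Properties as Unique
open import Data.Maybe using (Maybe; just; nothing; maybe′)
import Data.Maybe as Maybe
open import Data.Nat using (ℕ; zero; suc; _+_; _∸_; _⊔_; _≤_; _<_; z≤n; s≤s; s≤s⁻¹; _<ᵇ_; _≡ᵇ_)
open import Data.Nat.Properties
open import Algebra.Properties.CommutativeSemigroup +-commutativeSemigroup using (interchange)
open import Data.Product using (Σ; ∃-syntax; _×_; _,_; proj₁; proj₂)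
import Data.Product as Product
open import Data.Sum using (_⊎_; inj₁; inj₂)
import Data.Sum as Sum
open import Data.Vec using (Vec; []; _∷_; lookup; tabulate; zipWith; fromList; toList)
import Data.Vec.Properties as Vec
open import Function using (_∘_; id; case_of_; Equivalence)
open import Function.Bundles using (Inverse; mk↔ₛ′)
open import Function.Construct.Composition using (_↔-∘_)
open import Function.Construct.Identity using (↔-id)
open import Function.Construct.Symmetry using (↔-sym)
open import Relation.Binary.PropositionalEquality
open import Relation.Nullary using (¬_; yes; no; contradiction)
open import Relation.Nullary.Decidable using (⌊_⌋; T?; toWitness; fromWitness)
open import Defs

open Equivalence using (to; from)
open Inverse using (strictlyInverseˡ; strictlyInverseʳ)

T-all⁻ : ∀ {A : Set} (p : A → Bool) xs → T (all p xs) → All (T ∘ p) xs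
T-all⁻ p []       _ = []
T-all⁻ p (x ∷ xs) t = proj₁ (to T-∧ t) ∷ T-all⁻ p xs (proj₂ (to (T-∧ {p x}) t))

T-all⁺ : ∀ {A : Set} (p : A → Bool) {xs} → All (T ∘ p) xs → T (all p xs)
T-all⁺ p []         = _
T-all⁺ p (px ∷ pxs) = from T-∧ (px , T-all⁺ p pxs)

module _ {A : Set} where

  Unique-⊆⇒length-≤ : ∀ (xs ys : List A) → Unique xs → (∀ {x} → x ∈ xs → x ∈ ys) → length xs ≤ length ys
  Unique-⊆⇒length-≤ []       ys _           _   = z≤n
  Unique-⊆⇒length-≤ (x ∷ xs) ys (x∉xs ∷ xs!) xs⊆ys with ∈-∃++ (xs⊆ys (here refl))
  ... | ys₁ , ys₂ , refl = ≤-trans (s≤s (Unique-⊆⇒length-≤ xs (ys₁ ++ ys₂) xs! xs⊆ys₁ys₂)) (≤-reflexive length-eq)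
    where
    remove : ∀ {y} zs → y ∈ zs ++ x ∷ ys₂ → y ≢ x → y ∈ zs ++ ys₂
    remove []       (here y≡x) y≢x = contradiction y≡x y≢x
    remove []       (there y∈) _   = y∈
    remove (z ∷ zs) (here y≡z) _   = here y≡z
    remove (z ∷ zs) (there y∈) y≢x = there (remove zs y∈ y≢x)
    xs⊆ys₁ys₂ : ∀ {y} → y ∈ xs → y ∈ ys₁ ++ ys₂
    xs⊆ys₁ys₂ y∈xs = remove ys₁ (xs⊆ys (there y∈xs)) (λ y≡x → All.lookup x∉xs y∈xs (sym y≡x))
    length-eq : suc (length (ys₁ ++ ys₂)) ≡ length (ys₁ ++ x ∷ ys₂)
    length-eq = begin
      suc (length (ys₁ ++ ys₂))        ≡⟨ cong suc (length-++ ys₁) ⟩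
      suc (length ys₁ + length ys₂)    ≡⟨ sym (+-suc (length ys₁) (length ys₂)) ⟩
      length ys₁ + length (x ∷ ys₂)    ≡⟨ sym (length-++ ys₁) ⟩
      length (ys₁ ++ x ∷ ys₂)          ∎
      where open ≡-Reasoning

  concatMap⁺-disjoint : ∀ {B : Set} {f : A → List B} {xs} → Unique xs → (∀ x → Unique (f x)) →
                        (∀ {x x' y} → y ∈ f x → y ∈ f x' → x ≡ x') → Unique (concatMap f xs)
  concatMap⁺-disjoint {xs = []}     []           _  _        = []
  concatMap⁺-disjoint {f = f} {xs = x ∷ xs} (x∉xs ∷ xs!) f! disjoint =
    Unique.++⁺ (f! x) (concatMap⁺-disjoint xs! f! disjoint) λ (y∈fx , y∈rest) →
      let (x' , x'∈xs , y∈fx') = find (∈-concatMap⁻ f {xs = xs} y∈rest) in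
      All.lookup x∉xs x'∈xs (disjoint y∈fx y∈fx')

  map⁺-local : ∀ {B : Set} {f : A → B} {xs} → Unique xs →
               (∀ {x y} → x ∈ xs → y ∈ xs → f x ≡ f y → x ≡ y) → Unique (map f xs)
  map⁺-local {xs = []}     []           _   = []
  map⁺-local {xs = x ∷ xs} (x∉xs ∷ xs!) inj =
    All.map⁺ (All.tabulate (λ y∈xs fx≡fy → All.lookup x∉xs y∈xs (inj (here refl) (there y∈xs) fx≡fy)))
    ∷ map⁺-local xs! (λ x∈ y∈ → inj (there x∈) (there y∈))

countᵇ-≡-by-bijection : ∀ {A B : Set} (u : A → B) (p : A → Bool) (q : B → Bool) xs ys →
  Unique xs → Unique ys →
  (∀ {x x'} → x ∈ xs → T (p x) → x' ∈ xs → T (p x') → u x ≡ u x' → x ≡ x') →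
  (∀ {x} → x ∈ xs → T (p x) → u x ∈ ys × T (q (u x))) →
  (∀ {y} → y ∈ ys → T (q y) → ∃[ x ] x ∈ xs × T (p x) × u x ≡ y) →
  countᵇ p xs ≡ countᵇ q ys
countᵇ-≡-by-bijection {A} {B} u p q xs ys xs! ys! inj into onto = ≤-antisym
  (≤-trans (≤-reflexive (sym (length-map u pxs)))
    (Unique-⊆⇒length-≤ (map u pxs) qys (map⁺-local (Unique.filter⁺ (T? ∘ p) xs!) inj′) image⊆))
  (≤-trans (Unique-⊆⇒length-≤ qys (map u pxs) (Unique.filter⁺ (T? ∘ q) ys!) ⊆image)
    (≤-reflexive (length-map u pxs)))
  where
  pxs : List A
  pxs = filterᵇ p xs
  qys : List B
  qys = filterᵇ q ys
  inj′ : ∀ {x x'} → x ∈ pxs → x' ∈ pxs → u x ≡ u x' → x ≡ x'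
  inj′ x∈ x'∈ = let (a , b) = ∈-filter⁻ (T? ∘ p) {xs = xs} x∈ ; (c , d) = ∈-filter⁻ (T? ∘ p) {xs = xs} x'∈ in inj a b c d
  image⊆ : ∀ {y} → y ∈ map u pxs → y ∈ qys
  image⊆ y∈ with ∈-map⁻ u y∈
  ... | x , x∈ , refl = let (a , b) = ∈-filter⁻ (T? ∘ p) {xs = xs} x∈ ; (c , d) = into a b in ∈-filter⁺ (T? ∘ q) c d
  ⊆image : ∀ {y} → y ∈ qys → y ∈ map u pxs
  ⊆image y∈ with ∈-filter⁻ (T? ∘ q) {xs = ys} y∈
  ... | y∈ys , qy with onto y∈ys qy
  ... | x , x∈ , px , refl = ∈-map⁺ u (∈-filter⁺ (T? ∘ p) x∈ px)

allVecs-complete : ∀ {A : Set} (xs : List A) → (∀ a → a ∈ xs) → ∀ {l} (v : Vec A l) → v ∈ allVecs xs l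
allVecs-complete xs complete []      = here refl
allVecs-complete xs complete (a ∷ v) =
  ∈-concatMap⁺ _ (lose (complete a) (∈-map⁺ (a ∷_) (allVecs-complete xs complete v)))

allVecs-unique : ∀ {A : Set} (xs : List A) → Unique xs → ∀ l → Unique (allVecs xs l)
allVecs-unique xs xs! zero    = [] ∷ []
allVecs-unique xs xs! (suc l) = concatMap⁺-disjoint xs!
  (λ x → Unique.map⁺ Vec.∷-injectiveʳ (allVecs-unique xs xs! l))
  (λ m m' → let (_ , _ , e) = ∈-map⁻ _ m ; (_ , _ , e') = ∈-map⁻ _ m' in Vec.∷-injectiveˡ (trans (sym e) e'))

allSubsets-complete : ∀ n (S : Subset n) → S ∈ allSubsets n
allSubsets-complete n = allVecs-complete _ λ { true → here refl ; false → there (here refl) }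

allSubsets-unique : ∀ n → Unique (allSubsets n)
allSubsets-unique = allVecs-unique _ (((λ ()) ∷ []) ∷ [] ∷ [])

allSubsetLists-complete : ∀ n (F : List (Subset n)) → length F ≤ n → F ∈ allSubsetLists n
allSubsetLists-complete n F |F|≤n =
  ∈-concatMap⁺ (λ l → map toList (allVecs (allSubsets n) l)) (lose (∈-upTo⁺ (s≤s |F|≤n))
    (subst (_∈ map toList (allVecs (allSubsets n) (length F))) (Vec.toList∘fromList F)
      (∈-map⁺ toList (allVecs-complete _ (allSubsets-complete n) (fromList F)))))

allSubsetLists-unique : ∀ n → Unique (allSubsetLists n)
allSubsetLists-unique n = concatMap⁺-disjoint (Unique.upTo⁺ (suc n))
  (λ l → Unique.map⁺ (λ {v} {v'} e → trans (sym (Vec.cast-is-id refl v)) (Vec.toList-injective refl v v' e))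
                     (allVecs-unique _ (allSubsets-unique n) l))
  (λ m m' → let (v , _ , e) = ∈-map⁻ _ m ; (v' , _ , e') = ∈-map⁻ _ m' in
     trans (sym (Vec.length-toList v)) (trans (cong length (trans (sym e) e')) (Vec.length-toList v')))

indicator : Bool → ℕ
indicator true  = 1
indicator false = 0

countᵇ-∷ : ∀ {A : Set} (p : A → Bool) x xs → countᵇ p (x ∷ xs) ≡ indicator (p x) + countᵇ p xs
countᵇ-∷ p x xs with p x
... | true  = refl
... | false = refl

countᵇ-none : ∀ {A : Set} (p : A → Bool) {xs} → All (λ x → p x ≡ false) xs → countᵇ p xs ≡ 0
countᵇ-none p {[]}     _           = refl
countᵇ-none p {x ∷ xs} (px ∷ pxs) = trans (countᵇ-∷ p x xs) (cong₂ (λ b c → indicator b + c) px (countᵇ-none p pxs))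

<ᵇ-false : ∀ {a b} → b ≤ a → (a <ᵇ b) ≡ false
<ᵇ-false {a} {b} b≤a with a <ᵇ b in eq
... | true  = ⊥-elim (<⇒≱ (<ᵇ⇒< a b (subst T (sym eq) _)) b≤a)
... | false = refl

<ᵇ-true : ∀ {a b} → a < b → (a <ᵇ b) ≡ true
<ᵇ-true a<b = Equivalence.to T-≡ (<⇒<ᵇ a<b)

iterate-suc : ∀ o l → iterate suc (suc o) l ≡ map suc (iterate suc o l)
iterate-suc o zero    = refl
iterate-suc o (suc l) = cong (suc o ∷_) (iterate-suc (suc o) l)

module _ {A B : Set} where

  Pointwise-map-iterate : ∀ {R : A → B → Set} (f : ℕ → A) (g : ℕ → B) o l →
    (∀ m → o ≤ m → m < o + l → R (f m) (g m)) → Pointwise R (map f (iterate suc o l)) (map g (iterate suc o l))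
  Pointwise-map-iterate f g o zero    _   = []
  Pointwise-map-iterate f g o (suc l) fRg =
    fRg o ≤-refl (m<m+n o (s≤s z≤n)) ∷
    Pointwise-map-iterate f g (suc o) l λ m o<m m<o+l → fRg m (<⇒≤ o<m) (≤-trans m<o+l (≤-reflexive (sym (+-suc o l))))

map-iterate-≡⁻ : ∀ {A : Set} (f g : ℕ → A) o l → map f (iterate suc o l) ≡ map g (iterate suc o l) →
                 ∀ m → o ≤ m → m < o + l → f m ≡ g m
map-iterate-≡⁻ f g o zero    _  m o≤m m<o+0 = ⊥-elim (<⇒≱ m<o+0 (≤-trans (≤-reflexive (+-identityʳ o)) o≤m))
map-iterate-≡⁻ f g o (suc l) eq m o≤m m<o+l with m ≟ o
... | yes refl = ∷-injectiveˡ eq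
... | no m≢o   = map-iterate-≡⁻ f g (suc o) l (∷-injectiveʳ eq) m (≤∧≢⇒< o≤m (m≢o ∘ sym))
                   (≤-trans m<o+l (≤-reflexive (+-suc o l)))

All-iterate : ∀ {P : ℕ → Set} o l → (∀ m → o ≤ m → m < o + l → P m) → All P (iterate suc o l)
All-iterate o zero    _ = []
All-iterate o (suc l) p =
  p o ≤-refl (m<m+n o (s≤s z≤n)) ∷
  All-iterate (suc o) l λ m o<m m<o+l → p m (<⇒≤ o<m) (≤-trans m<o+l (≤-reflexive (sym (+-suc o l))))

module _ {A : Set} (p : A → Bool) where

  filterᵇ-∷-cong : ∀ x {xs ys} → filterᵇ p xs ≡ filterᵇ p ys → filterᵇ p (x ∷ xs) ≡ filterᵇ p (x ∷ ys)
  filterᵇ-∷-cong x eq with p x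
  ... | true  = cong (x ∷_) eq
  ... | false = eq

  filterᵇ-∷-cancel : ∀ x {xs ys} → T (p x) → filterᵇ p (x ∷ xs) ≡ filterᵇ p (x ∷ ys) → filterᵇ p xs ≡ filterᵇ p ys
  filterᵇ-∷-cancel x px eq with p x
  ... | true = ∷-injectiveʳ eq

  any≡0<ᵇcountᵇ : ∀ xs → any p xs ≡ (0 <ᵇ countᵇ p xs)
  any≡0<ᵇcountᵇ []       = refl
  any≡0<ᵇcountᵇ (x ∷ xs) with p x
  ... | true  = refl
  ... | false = any≡0<ᵇcountᵇ xs

filterᵇ-map : ∀ {A B : Set} (q : B → Bool) (f : A → B) xs → filterᵇ q (map f xs) ≡ map f (filterᵇ (q ∘ f) xs)
filterᵇ-map q f []       = refl
filterᵇ-map q f (x ∷ xs) with q (f x)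
... | true  = cong (f x ∷_) (filterᵇ-map q f xs)
... | false = filterᵇ-map q f xs

filterᵇ-cong : ∀ {A : Set} {p q : A → Bool} → (∀ x → p x ≡ q x) → ∀ xs → filterᵇ p xs ≡ filterᵇ q xs
filterᵇ-cong p≗q []       = refl
filterᵇ-cong {p = p} {q} p≗q (x ∷ xs) with p x | q x | p≗q x
... | true  | true  | _ = cong (x ∷_) (filterᵇ-cong p≗q xs)
... | false | false | _ = filterᵇ-cong p≗q xs

≤-foldr-⊔ : ∀ {x} xs → x ∈ xs → x ≤ foldr _⊔_ 0 xs
≤-foldr-⊔ (y ∷ xs) (here refl) = m≤m⊔n y _
≤-foldr-⊔ (y ∷ xs) (there x∈)  = ≤-trans (≤-foldr-⊔ xs x∈) (m≤n⊔m y _)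

upTo≡map-toℕ-allFin : ∀ K → upTo K ≡ map toℕ (allFin K)
upTo≡map-toℕ-allFin zero    = refl
upTo≡map-toℕ-allFin (suc K) = cong (0 ∷_) (begin
  applyUpTo suc K                       ≡⟨ map-upTo suc K ⟨
  map suc (upTo K)                      ≡⟨ cong (map suc) (upTo≡map-toℕ-allFin K) ⟩
  map suc (map toℕ (allFin K))          ≡⟨ map-∘ (allFin K) ⟨
  map (toℕ ∘ Fin.suc) (allFin K)        ≡⟨ map-∘ (allFin K) ⟩
  map toℕ (map Fin.suc (allFin K))      ≡⟨ cong (map toℕ) (map-tabulate id Fin.suc) ⟩
  map toℕ (List.tabulate Fin.suc)       ∎)
  where open ≡-Reasoning

filterᵇ-upTo : ∀ (p : ℕ → Bool) a b → (∀ i → T (p i) → i < a) → (∀ i → T (p i) → i < b) →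
               filterᵇ p (upTo a) ≡ filterᵇ p (upTo b)
filterᵇ-upTo p a b p<a p<b = trans (extend a (rejects p<a) b)
  (trans (cong (filterᵇ p ∘ upTo) (+-comm a b)) (sym (extend b (rejects p<b) a)))
  where
  rejects : ∀ {c} → (∀ i → T (p i) → i < c) → ∀ i → c ≤ i → p i ≡ false
  rejects p<c i c≤i with p i in eq
  ... | true  = ⊥-elim (<⇒≱ (p<c i (subst T (sym eq) _)) c≤i)
  ... | false = refl
  extend : ∀ c → (∀ i → c ≤ i → p i ≡ false) → ∀ d → filterᵇ p (upTo c) ≡ filterᵇ p (upTo (c + d))
  extend c reject zero    = cong (filterᵇ p ∘ upTo) (sym (+-identityʳ c))
  extend c reject (suc d) = begin
    filterᵇ p (upTo c)                                   ≡⟨ extend c reject d ⟩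
    filterᵇ p (upTo (c + d))                             ≡⟨ ++-identityʳ _ ⟨
    filterᵇ p (upTo (c + d)) ++ []                       ≡⟨ cong (filterᵇ p (upTo (c + d)) ++_) last ⟨
    filterᵇ p (upTo (c + d)) ++ filterᵇ p (c + d ∷ [])   ≡⟨ filter-++ _ (upTo (c + d)) (c + d ∷ []) ⟨
    filterᵇ p (upTo (c + d) ++ c + d ∷ [])               ≡⟨ cong (filterᵇ p) (upTo-∷ʳ (c + d)) ⟩
    filterᵇ p (upTo (suc (c + d)))                       ≡⟨ cong (filterᵇ p ∘ upTo) (+-suc c d) ⟨
    filterᵇ p (upTo (c + suc d))                         ∎
    where
    open ≡-Reasoning
    last : filterᵇ p (c + d ∷ []) ≡ []
    last rewrite reject (c + d) (m≤m+n c d) = refl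

module Increasing {A : Set} (key : A → ℕ) where

  Increasing : List A → Set
  Increasing = AllPairs (λ a b → key a < key b)

  index : List A → A → ℕ
  index xs x = countᵇ (λ y → key y <ᵇ key x) xs

  nth : List A → ℕ → A → A
  nth []       m       d = d
  nth (y ∷ xs) zero    d = y
  nth (y ∷ xs) (suc m) d = nth xs m d

  index-head : ∀ y xs → Increasing (y ∷ xs) → index (y ∷ xs) y ≡ 0
  index-head y xs (y<xs ∷ _) = trans (countᵇ-∷ _ y xs)
    (cong₂ (λ b c → indicator b + c) (<ᵇ-false (≤-refl {key y}))
      (countᵇ-none _ (All.map (<ᵇ-false ∘ <⇒≤) y<xs)))

  index-there : ∀ y xs x → Increasing (y ∷ xs) → x ∈ xs → index (y ∷ xs) x ≡ suc (index xs x)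
  index-there y xs x (y<xs ∷ _) x∈xs =
    trans (countᵇ-∷ _ y xs) (cong (λ b → indicator b + index xs x) (<ᵇ-true (All.lookup y<xs x∈xs)))

  nth-index : ∀ xs x d → Increasing xs → x ∈ xs → nth xs (index xs x) d ≡ x
  nth-index (y ∷ xs) x d inc         (here refl) rewrite index-head y xs inc = refl
  nth-index (y ∷ xs) x d inc@(_ ∷ inc′) (there x∈) rewrite index-there y xs x inc x∈ = nth-index xs x d inc′ x∈

  index-< : ∀ xs x → Increasing xs → x ∈ xs → index xs x < length xs
  index-< (y ∷ xs) x inc         (here refl) rewrite index-head y xs inc = s≤s z≤n
  index-< (y ∷ xs) x inc@(_ ∷ inc′) (there x∈) rewrite index-there y xs x inc x∈ = s≤s (index-< xs x inc′ x∈)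

  nth-∈ : ∀ xs m d → m < length xs → nth xs m d ∈ xs
  nth-∈ (y ∷ xs) zero    d _         = here refl
  nth-∈ (y ∷ xs) (suc m) d (s≤s m<) = there (nth-∈ xs m d m<)

  index-nth : ∀ xs m d → Increasing xs → m < length xs → index xs (nth xs m d) ≡ m
  index-nth (y ∷ xs) zero    d inc              _         = index-head y xs inc
  index-nth (y ∷ xs) (suc m) d inc@(_ ∷ inc′) (s≤s m<) =
    trans (index-there y xs (nth xs m d) inc (nth-∈ xs m d m<)) (cong suc (index-nth xs m d inc′ m<))

  nth-injective : ∀ xs m m' d → Increasing xs → m < length xs → m' < length xs → nth xs m d ≡ nth xs m' d → m ≡ m'
  nth-injective xs m m' d inc m< m'< eq =
    trans (sym (index-nth xs m d inc m<)) (trans (cong (index xs) eq) (index-nth xs m' d inc m'<))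

  map-nth : ∀ xs d → map (λ m → nth xs m d) (iterate suc 0 (length xs)) ≡ xs
  map-nth []       d = refl
  map-nth (y ∷ xs) d = cong (y ∷_) (begin
    map (λ m → nth (y ∷ xs) m d) (iterate suc 1 (length xs))             ≡⟨ cong (map _) (iterate-suc 0 (length xs)) ⟩
    map (λ m → nth (y ∷ xs) m d) (map suc (iterate suc 0 (length xs)))   ≡⟨ map-∘ (iterate suc 0 (length xs)) ⟨
    map (λ m → nth xs m d) (iterate suc 0 (length xs))                   ≡⟨ map-nth xs d ⟩
    xs                                                                   ∎)
    where open ≡-Reasoning

countF-suc : ∀ {n} (Q : Fin (suc n) → Bool) → countF Q ≡ indicator (Q Fin.zero) + countF (Q ∘ Fin.suc)
countF-suc Q with Q Fin.zero
... | true  = refl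
... | false = refl

countF-cong : ∀ {n} {Q Q' : Fin n → Bool} → (∀ j → Q j ≡ Q' j) → countF Q ≡ countF Q'
countF-cong {zero}  _  = refl
countF-cong {suc n} {Q} {Q'} Q≗Q' = begin
  countF Q                                          ≡⟨ countF-suc Q ⟩
  indicator (Q Fin.zero) + countF (Q ∘ Fin.suc)     ≡⟨ cong₂ _+_ (cong indicator (Q≗Q' Fin.zero)) (countF-cong (Q≗Q' ∘ Fin.suc)) ⟩
  indicator (Q' Fin.zero) + countF (Q' ∘ Fin.suc)   ≡⟨ countF-suc Q' ⟨
  countF Q'                                         ∎
  where open ≡-Reasoning

countF-+ : ∀ {n} (Q Q₁ Q₂ : Fin n → Bool) → (∀ j → indicator (Q j) ≡ indicator (Q₁ j) + indicator (Q₂ j)) →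
           countF Q ≡ countF Q₁ + countF Q₂
countF-+ {zero}  _ _ _ _ = refl
countF-+ {suc n} Q Q₁ Q₂ additive = begin
  countF Q
    ≡⟨ countF-suc Q ⟩
  indicator (Q Fin.zero) + countF (Q ∘ Fin.suc)
    ≡⟨ cong₂ _+_ (additive Fin.zero) (countF-+ (Q ∘ Fin.suc) (Q₁ ∘ Fin.suc) (Q₂ ∘ Fin.suc) (additive ∘ Fin.suc)) ⟩
  (indicator (Q₁ Fin.zero) + indicator (Q₂ Fin.zero)) + (countF (Q₁ ∘ Fin.suc) + countF (Q₂ ∘ Fin.suc))
    ≡⟨ interchange (indicator (Q₁ Fin.zero)) (indicator (Q₂ Fin.zero)) (countF (Q₁ ∘ Fin.suc)) (countF (Q₂ ∘ Fin.suc)) ⟩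
  (indicator (Q₁ Fin.zero) + countF (Q₁ ∘ Fin.suc)) + (indicator (Q₂ Fin.zero) + countF (Q₂ ∘ Fin.suc))
    ≡⟨ cong₂ _+_ (countF-suc Q₁) (countF-suc Q₂) ⟨
  countF Q₁ + countF Q₂
    ∎
  where open ≡-Reasoning

countF-≤ : ∀ {n} (Q : Fin n → Bool) → countF Q ≤ n
countF-≤ {zero}  _ = z≤n
countF-≤ {suc n} Q with Q Fin.zero
... | true  = s≤s (countF-≤ (Q ∘ Fin.suc))
... | false = m≤n⇒m≤1+n (countF-≤ (Q ∘ Fin.suc))

countF-const-true : ∀ {n} (Q : Fin n → Bool) → (∀ j → T (Q j)) → countF Q ≡ n
countF-const-true {zero}  _ _ = refl
countF-const-true {suc n} Q all-true with Q Fin.zero | all-true Fin.zero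
... | true | _ = cong suc (countF-const-true (Q ∘ Fin.suc) (all-true ∘ Fin.suc))

countF-const-false : ∀ {n} (Q : Fin n → Bool) → (∀ j → Q j ≡ false) → countF Q ≡ 0
countF-const-false {zero}  _ _ = refl
countF-const-false {suc n} Q all-false rewrite all-false Fin.zero = countF-const-false (Q ∘ Fin.suc) (all-false ∘ Fin.suc)

countF-witness : ∀ {n} (Q : Fin n → Bool) → 0 < countF Q → Σ (Fin n) (T ∘ Q)
countF-witness {suc n} Q pos with Q Fin.zero in eq
... | true  = Fin.zero , subst T (sym eq) _
... | false = let (j , t) = countF-witness (Q ∘ Fin.suc) pos in Fin.suc j , t

countF-positive : ∀ {n} (Q : Fin n → Bool) j → T (Q j) → 0 < countF Q
countF-positive {suc n} Q Fin.zero    t with Q Fin.zero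
... | true = s≤s z≤n
countF-positive {suc n} Q (Fin.suc j) t with Q Fin.zero
... | true  = s≤s z≤n
... | false = countF-positive (Q ∘ Fin.suc) j t

countF-complement : ∀ {n} (Q : Fin n → Bool) → countF Q + countF (not ∘ Q) ≡ n
countF-complement Q =
  trans (sym (countF-+ (λ _ → true) Q (not ∘ Q) one≡)) (countF-const-true (λ _ → true) (λ _ → _))
  where
  one≡ : ∀ j → 1 ≡ indicator (Q j) + indicator (not (Q j))
  one≡ j with Q j
  ... | true  = refl
  ... | false = refl

countᵇ-tabulate : ∀ {A : Set} {n} (Q : A → Bool) (f : Fin n → A) → countᵇ Q (List.tabulate f) ≡ countF (Q ∘ f)
countᵇ-tabulate {n = zero}  Q f = refl
countᵇ-tabulate {n = suc n} Q f with Q (f Fin.zero)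
... | true  = cong suc (countᵇ-tabulate Q (f ∘ Fin.suc))
... | false = countᵇ-tabulate Q (f ∘ Fin.suc)

countᵇ-allFin : ∀ {n} (Q : Fin n → Bool) → countᵇ Q (allFin n) ≡ countF Q
countᵇ-allFin Q = countᵇ-tabulate Q id

∣∣≡countF : ∀ {n} (S : Subset n) → ∣ S ∣ ≡ countF (lookup S)
∣∣≡countF []          = refl
∣∣≡countF (true ∷ S)  = cong suc (∣∣≡countF S)
∣∣≡countF (false ∷ S) = ∣∣≡countF S

≮ᵇ⇒≡ᵇ : ∀ a o → a ≤ o → not (a <ᵇ o) ≡ (a ≡ᵇ o)
≮ᵇ⇒≡ᵇ zero    zero    _         = refl
≮ᵇ⇒≡ᵇ zero    (suc o) _         = refl
≮ᵇ⇒≡ᵇ (suc a) (suc o) (s≤s a≤o) = ≮ᵇ⇒≡ᵇ a o a≤o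

<ᵇ1≡≡ᵇ0 : ∀ a → (a <ᵇ 1) ≡ (a ≡ᵇ 0)
<ᵇ1≡≡ᵇ0 zero    = refl
<ᵇ1≡≡ᵇ0 (suc a) = refl

<ᵇsuc∧≮ᵇ≡≡ᵇ : ∀ a o → ((a <ᵇ suc o) ∧ not (a <ᵇ o)) ≡ (a ≡ᵇ o)
<ᵇsuc∧≮ᵇ≡≡ᵇ zero          zero    = refl
<ᵇsuc∧≮ᵇ≡≡ᵇ zero          (suc o) = refl
<ᵇsuc∧≮ᵇ≡≡ᵇ (suc zero)    zero    = refl
<ᵇsuc∧≮ᵇ≡≡ᵇ (suc (suc a)) zero    = refl
<ᵇsuc∧≮ᵇ≡≡ᵇ (suc a)       (suc o) = <ᵇsuc∧≮ᵇ≡≡ᵇ a o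

indicator-<ᵇsuc : ∀ a o → indicator (a <ᵇ suc o) ≡ indicator (a <ᵇ o) + indicator (a ≡ᵇ o)
indicator-<ᵇsuc zero          zero    = refl
indicator-<ᵇsuc zero          (suc o) = refl
indicator-<ᵇsuc (suc zero)    zero    = refl
indicator-<ᵇsuc (suc (suc a)) zero    = refl
indicator-<ᵇsuc (suc a)       (suc o) = indicator-<ᵇsuc a o

-- Permuting subsets

countF-∘-permutation : ∀ {n} (π : Permutation′ n) (Q : Fin n → Bool) → countF (Q ∘ (π ⟨$⟩ʳ_)) ≡ countF Q
countF-∘-permutation {n} π Q = begin
  countF (Q ∘ (π ⟨$⟩ʳ_))                 ≡⟨ countᵇ-allFin (Q ∘ (π ⟨$⟩ʳ_)) ⟨
  countᵇ (Q ∘ (π ⟨$⟩ʳ_)) (allFin n)      ≡⟨ countᵇ-≡-by-bijection (π ⟨$⟩ʳ_) _ Q (allFin n) (allFin n) (Unique.allFin⁺ n) (Unique.allFin⁺ n)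
                                              (λ _ _ _ _ πi≡πi' → trans (sym (inverseˡ π)) (trans (cong (π ⟨$⟩ˡ_) πi≡πi') (inverseˡ π)))
                                              (λ _ t → ∈-allFin _ , t)
                                              (λ {j} _ t → π ⟨$⟩ˡ j , ∈-allFin _ , subst (T ∘ Q) (sym (inverseʳ π)) t , inverseʳ π) ⟩
  countᵇ Q (allFin n)                     ≡⟨ countᵇ-allFin Q ⟩
  countF Q                                ∎
  where open ≡-Reasoning

module _ {n} (π : Permutation′ n) where

  permute : Subset n → Subset n
  permute S = tabulate (lookup S ∘ (π ⟨$⟩ʳ_))

  lookup-permute : ∀ S j → lookup (permute S) j ≡ lookup S (π ⟨$⟩ʳ j)
  lookup-permute S = Vec.lookup∘tabulate (lookup S ∘ (π ⟨$⟩ʳ_))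

  ∈-permute⁻ : ∀ {S j} → j ∈ₛ permute S → π ⟨$⟩ʳ j ∈ₛ S
  ∈-permute⁻ {S} {j} j∈ = Vec.lookup⇒[]= _ S (trans (sym (lookup-permute S j)) (Vec.[]=⇒lookup j∈))

  ∈-permute⁺ : ∀ {S j} → π ⟨$⟩ʳ j ∈ₛ S → j ∈ₛ permute S
  ∈-permute⁺ {S} {j} πj∈ = Vec.lookup⇒[]= j _ (trans (lookup-permute S j) (Vec.[]=⇒lookup πj∈))

  ∣permute∣ : ∀ S → ∣ permute S ∣ ≡ ∣ S ∣
  ∣permute∣ S = begin
    ∣ permute S ∣                       ≡⟨ ∣∣≡countF (permute S) ⟩
    countF (lookup (permute S))         ≡⟨ countF-cong (lookup-permute S) ⟩
    countF (lookup S ∘ (π ⟨$⟩ʳ_))       ≡⟨ countF-∘-permutation π (lookup S) ⟩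
    countF (lookup S)                   ≡⟨ ∣∣≡countF S ⟨
    ∣ S ∣                               ∎
    where open ≡-Reasoning

  permute-⊂ : ∀ {S S'} → S ⊂ S' → permute S ⊂ permute S'
  permute-⊂ {S} {S'} (S⊆S' , x , x∈S' , x∉S) =
    (λ j∈ → ∈-permute⁺ (S⊆S' (∈-permute⁻ j∈))) ,
    π ⟨$⟩ˡ x ,
    ∈-permute⁺ (subst (_∈ₛ S') (sym (inverseʳ π)) x∈S') ,
    (λ x∈ → x∉S (subst (_∈ₛ S) (inverseʳ π) (∈-permute⁻ x∈)))

permute-flip : ∀ {n} (π : Permutation′ n) S → permute (flip π) (permute π S) ≡ S
permute-flip π S = trans (Vec.tabulate-cong λ j → trans (lookup-permute π S _) (cong (lookup S) (inverseʳ π)))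
                         (Vec.tabulate∘lookup S)

permute-injective : ∀ {n} (π : Permutation′ n) {S S'} → permute π S ≡ permute π S' → S ≡ S'
permute-injective π {S} {S'} eq =
  trans (sym (permute-flip π S)) (trans (cong (permute (flip π)) eq) (permute-flip π S'))

permute-⊂⁻ : ∀ {n} (π : Permutation′ n) {S S'} → permute π S ⊂ permute π S' → S ⊂ S'
permute-⊂⁻ π {S} {S'} = subst₂ _⊂_ (permute-flip π S) (permute-flip π S') ∘ permute-⊂ (flip π)

⊂?-permute : ∀ {n} (π : Permutation′ n) S S' → ⌊ permute π S ⊂? permute π S' ⌋ ≡ ⌊ S ⊂? S' ⌋
⊂?-permute π S S' with permute π S ⊂? permute π S' | S ⊂? S'
... | yes _   | yes _  = refl
... | no  _   | no  _  = refl
... | yes πS⊂ | no  ∌  = contradiction (permute-⊂⁻ π πS⊂) ∌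
... | no  ∌   | yes S⊂ = contradiction (permute-⊂ π S⊂) ∌

Vec-≡ : ∀ {A : Set} {n} {xs ys : Vec A n} → (∀ j → lookup xs j ≡ lookup ys j) → xs ≡ ys
Vec-≡ {xs = xs} {ys} eq = trans (sym (Vec.tabulate∘lookup xs)) (trans (Vec.tabulate-cong eq) (Vec.tabulate∘lookup ys))

module _ {n} (π : Permutation′ n) where

  permute-zipWith : ∀ (f : Bool → Bool → Bool) S S' → permute π (zipWith f S S') ≡ zipWith f (permute π S) (permute π S')
  permute-zipWith f S S' = Vec-≡ λ j → begin
    lookup (permute π (zipWith f S S')) j                   ≡⟨ lookup-permute π (zipWith f S S') j ⟩
    lookup (zipWith f S S') (π ⟨$⟩ʳ j)                      ≡⟨ Vec.lookup-zipWith f (π ⟨$⟩ʳ j) S S' ⟩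
    f (lookup S (π ⟨$⟩ʳ j)) (lookup S' (π ⟨$⟩ʳ j))          ≡⟨ cong₂ f (lookup-permute π S j) (lookup-permute π S' j) ⟨
    f (lookup (permute π S) j) (lookup (permute π S') j)    ≡⟨ Vec.lookup-zipWith f j (permute π S) (permute π S') ⟨
    lookup (zipWith f (permute π S) (permute π S')) j       ∎
    where open ≡-Reasoning

  permute-∁ : ∀ S → permute π (∁ S) ≡ ∁ (permute π S)
  permute-∁ S = Vec-≡ λ j → trans (lookup-permute π (∁ S) j)
    (trans (Vec.lookup-map (π ⟨$⟩ʳ j) not S) (trans (cong not (sym (lookup-permute π S j))) (sym (Vec.lookup-map j not (permute π S)))))

  permute-⊤ : permute π ⊤ ≡ ⊤
  permute-⊤ = Vec-≡ λ j → trans (lookup-permute π ⊤ j) (trans (Vec.lookup-replicate (π ⟨$⟩ʳ j) true) (sym (Vec.lookup-replicate j true)))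

module _ {n : ℕ} where

  composition-blocks : Subset n → List (Subset n) → List (Subset n)
  composition-blocks prev []       = ∁ prev ∷ []
  composition-blocks prev (G ∷ Gs) = (G ─ prev) ∷ composition-blocks G Gs

  composition : List (Subset n) → List (Subset n)
  composition []       = ⊤ ∷ []
  composition (F ∷ Fs) = F ∷ composition-blocks F Fs

  module _ (π : Permutation′ n) where

    composition-blocks-permute : ∀ prev Fs →
      composition-blocks (permute π prev) (map (permute π) Fs) ≡ map (permute π) (composition-blocks prev Fs)
    composition-blocks-permute prev []       = cong (_∷ []) (sym (permute-∁ π prev))
    composition-blocks-permute prev (G ∷ Gs) =
      cong₂ _∷_ (sym (permute-zipWith π _ G prev)) (composition-blocks-permute G Gs)

    composition-permute : ∀ F → composition (map (permute π) F) ≡ map (permute π) (composition F)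
    composition-permute []       = cong (_∷ []) (sym (permute-⊤ π))
    composition-permute (F ∷ Fs) = cong (permute π F ∷_) (composition-blocks-permute F Fs)

-- Invariance of φ_C under automorphisms of h

Σ-T-≡ : ∀ {A : Set} {P : A → Bool} {a a' : A} {t : T (P a)} {t' : T (P a')} →
        a ≡ a' → _≡_ {A = Σ A (T ∘ P)} (a , t) (a' , t')
Σ-T-≡ refl = cong (_ ,_) (T-irrelevant _ _)

split-inj₁ : (A : FinSet) (P : Carrier A → Bool) (a : Carrier A) (t : T (P a)) → ⇑d (split A P) a ≡ inj₁ (a , t)
split-inj₁ A P a t = strictlyInverseˡ (Decomp.iso (split A P)) (inj₁ (a , t))

split-inj₂ : (A : FinSet) (P : Carrier A → Bool) (a : Carrier A) (t : T (not (P a))) → ⇑d (split A P) a ≡ inj₂ (a , t)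
split-inj₂ A P a t = strictlyInverseˡ (Decomp.iso (split A P)) (inj₂ (a , t))

restrictBij : {A A' : FinSet} (σ : Bij A A') (P : Carrier A → Bool) (P' : Carrier A' → Bool) →
              (∀ a → P' (⇑ σ a) ≡ P a) → Bij (A ∣ P) (A' ∣ P')
restrictBij {A} {A'} σ P P' P'∘σ≗P = bij (mk↔ₛ′ forth back forth∘back back∘forth)
  where
  forth : Σ (Carrier A) (T ∘ P) → Σ (Carrier A') (T ∘ P')
  forth (a , p) = ⇑ σ a , subst T (sym (P'∘σ≗P a)) p
  back : Σ (Carrier A') (T ∘ P') → Σ (Carrier A) (T ∘ P)
  back (a' , p') = ⇓ σ a' , subst T (trans (cong P' (sym (strictlyInverseˡ (Bij.iso σ) a'))) (P'∘σ≗P (⇓ σ a'))) p'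
  forth∘back : ∀ y → forth (back y) ≡ y
  forth∘back (a' , _) = Σ-T-≡ (strictlyInverseˡ (Bij.iso σ) a')
  back∘forth : ∀ x → back (forth x) ≡ x
  back∘forth (a , _) = Σ-T-≡ (strictlyInverseʳ (Bij.iso σ) a)

module Transport (Hp : LinHopf) (χ : Character Hp) where
  open LinHopf Hp
  open Character χ
  open Theory Hp χ

  φ-product : Maybe (List (Σ FinSet H)) → Bool
  φ-product = maybe′ (all (φ ∘ proj₂)) false

  φ-product-∷ : (z : Σ FinSet H) (m : Maybe (List (Σ FinSet H))) →
                φ-product (Maybe.map (z ∷_) m) ≡ (φ (proj₂ z) ∧ φ-product m)
  φ-product-∷ z nothing with φ (proj₂ z)
  ... | true  = refl
  ... | false = refl
  φ-product-∷ z (just _) = refl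

  Related : {X X' : Set} → (X → X') → (X → Bool) → (X' → Bool) → Set
  Related τ B B' = ∀ x → B' (τ x) ≡ B x

  φ-ΔC⁺-transport : {X X' : Set} (τ : X → X') {A A' : FinSet} (σ : Bij A A')
    (ι : Carrier A → X) (ι' : Carrier A' → X') → (∀ a → ι' (⇑ σ a) ≡ τ (ι a)) →
    (B : X → Bool) (B' : X' → Bool) → Related τ B B' →
    (Bs : List (X → Bool)) (Bs' : List (X' → Bool)) → Pointwise (Related τ) Bs Bs' →
    (x : H A) → φ-product (ΔC⁺ A ι B Bs x) ≡ φ-product (ΔC⁺ A' ι' B' Bs' (Hmap σ x))
  φ-ΔC⁺-transport τ σ ι ι' ισ B B' BB' [] [] [] x = cong (_∧ true) (sym (φ-nat σ x))
  φ-ΔC⁺-transport τ {A} {A'} σ ι ι' ισ B B' BB' (C ∷ Cs) (C' ∷ Cs') (CC' ∷ CsCs') x =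
    step (Δ (split A (B ∘ ι)) x) (Δ (split A' (B' ∘ ι')) (Hmap σ x))
         (Δ-nat (split A (B ∘ ι)) (split A' (B' ∘ ι')) α β σ splits-commute x)
    where
    B'ι'σ≗Bι : ∀ a → B' (ι' (⇑ σ a)) ≡ B (ι a)
    B'ι'σ≗Bι a = trans (cong B' (ισ a)) (BB' (ι a))
    α : Bij (A ∣ (B ∘ ι)) (A' ∣ (B' ∘ ι'))
    α = restrictBij σ (B ∘ ι) (B' ∘ ι') B'ι'σ≗Bι
    β : Bij (A ∣ (not ∘ B ∘ ι)) (A' ∣ (not ∘ B' ∘ ι'))
    β = restrictBij σ (not ∘ B ∘ ι) (not ∘ B' ∘ ι') (cong not ∘ B'ι'σ≗Bι)
    splits-commute′ : ∀ a b → B (ι a) ≡ b →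
      ⇑d (split A' (B' ∘ ι')) (⇑ σ a) ≡ Sum.map (⇑ α) (⇑ β) (⇑d (split A (B ∘ ι)) a)
    splits-commute′ a true  eq = let t = subst T (sym eq) _ in
      trans (split-inj₁ A' (B' ∘ ι') (⇑ σ a) (subst T (sym (B'ι'σ≗Bι a)) t))
            (cong (Sum.map (⇑ α) (⇑ β)) (sym (split-inj₁ A (B ∘ ι) a t)))
    splits-commute′ a false eq = let t = subst T (sym (cong not eq)) _ in
      trans (split-inj₂ A' (B' ∘ ι') (⇑ σ a) (subst T (sym (cong not (B'ι'σ≗Bι a))) t))
            (cong (Sum.map (⇑ α) (⇑ β)) (sym (split-inj₂ A (B ∘ ι) a t)))
    splits-commute : ∀ a → ⇑d (split A' (B' ∘ ι')) (⇑ σ a) ≡ Sum.map (⇑ α) (⇑ β) (⇑d (split A (B ∘ ι)) a)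
    splits-commute a = splits-commute′ a (B (ι a)) refl
    step : (m : Maybe (H (A ∣ (B ∘ ι)) × H (A ∣ (not ∘ B ∘ ι))))
           (m' : Maybe (H (A' ∣ (B' ∘ ι')) × H (A' ∣ (not ∘ B' ∘ ι')))) →
           m' ≡ Maybe.map (Product.map (Hmap α) (Hmap β)) m →
           φ-product (maybe′ (λ xy → Maybe.map ((A ∣ (B ∘ ι) , proj₁ xy) ∷_)
                                     (ΔC⁺ (A ∣ (not ∘ B ∘ ι)) (ι ∘ proj₁) C Cs (proj₂ xy))) nothing m)
           ≡ φ-product (maybe′ (λ xy → Maybe.map ((A' ∣ (B' ∘ ι') , proj₁ xy) ∷_)
                                     (ΔC⁺ (A' ∣ (not ∘ B' ∘ ι')) (ι' ∘ proj₁) C' Cs' (proj₂ xy))) nothing m')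
    step nothing        _ refl = refl
    step (just (y , z)) _ refl = begin
      φ-product (Maybe.map ((A ∣ (B ∘ ι) , y) ∷_) (ΔC⁺ _ (ι ∘ proj₁) C Cs z))
        ≡⟨ φ-product-∷ _ (ΔC⁺ _ (ι ∘ proj₁) C Cs z) ⟩
      φ y ∧ φ-product (ΔC⁺ _ (ι ∘ proj₁) C Cs z)
        ≡⟨ cong₂ _∧_ (sym (φ-nat α y)) (φ-ΔC⁺-transport τ β (ι ∘ proj₁) (ι' ∘ proj₁) (ισ ∘ proj₁) C C' CC' Cs Cs' CsCs' z) ⟩
      φ (Hmap α y) ∧ φ-product (ΔC⁺ _ (ι' ∘ proj₁) C' Cs' (Hmap β z))
        ≡⟨ φ-product-∷ _ (ΔC⁺ _ (ι' ∘ proj₁) C' Cs' (Hmap β z)) ⟨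
      φ-product (Maybe.map ((A' ∣ (B' ∘ ι') , Hmap α y) ∷_) (ΔC⁺ _ (ι' ∘ proj₁) C' Cs' (Hmap β z)))
        ∎
      where open ≡-Reasoning

  φC-invariant : (N : FinSet) (h : H N) (σ : Bij N N) → Hmap σ h ≡ h →
                 (Bs Bs' : List (Carrier N → Bool)) → Pointwise (Related (⇑ σ)) Bs Bs' → φC N Bs h ≡ φC N Bs' h
  φC-invariant N h σ σh≡h []       []         []            = refl
  φC-invariant N h σ σh≡h (B ∷ Bs) (B' ∷ Bs') (BB' ∷ BsBs') =
    trans (φ-ΔC⁺-transport (⇑ σ) σ id id (λ _ → refl) B B' BB' Bs Bs' BsBs' h)
          (cong (φ-product ∘ ΔC⁺ N id B' Bs') σh≡h)

  φC-cong : (N : FinSet) (h : H N) (Bs Bs' : List (Carrier N → Bool)) →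
            Pointwise (Related id) Bs Bs' → φC N Bs h ≡ φC N Bs' h
  φC-cong N h = φC-invariant N h idBij (Hmap-id idBij (λ _ → refl) h)
    where idBij = bij (↔-id _)

module Automorphism (Hp : LinHopf) (χ : Character Hp) (N : FinSet) (h : LinHopf.H Hp N) where
  open LinHopf Hp
  open Theory Hp χ
  open OnSet N h
  open Transport Hp χ

  -- actSub g is definitionally permute (induced g)
  induced : Bij N N → Permutation′ n
  induced g = enum N ↔-∘ (↔-sym (Bij.iso g) ↔-∘ ↔-sym (enum N))

  -- compOf's helper is local to compOf; the tail of compOf (G ∷ Gs) is that helper applied to G and Gs.
  compOf≡composition : ∀ F → compOf F ≡ composition F
  compOf≡composition []           = refl
  compOf≡composition (S ∷ [])     = refl
  compOf≡composition (S ∷ G ∷ Gs) = cong (λ blocks → S ∷ (G ─ S) ∷ List.drop 1 blocks) (compOf≡composition (G ∷ Gs))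

  ⟪actSub⟫ : ∀ g S x → ⟪ actSub g S ⟫ (⇑ g x) ≡ ⟪ S ⟫ x
  ⟪actSub⟫ g S x = begin
    lookup (actSub g S) (Inverse.to (enum N) (⇑ g x))   ≡⟨ Vec.lookup∘tabulate _ (Inverse.to (enum N) (⇑ g x)) ⟩
    ⟪ S ⟫ (⇓ g (elt (Inverse.to (enum N) (⇑ g x))))     ≡⟨ cong (⟪ S ⟫ ∘ ⇓ g) (strictlyInverseʳ (enum N) (⇑ g x)) ⟩
    ⟪ S ⟫ (⇓ g (⇑ g x))                                 ≡⟨ cong ⟪ S ⟫ (strictlyInverseʳ (Bij.iso g) x) ⟩
    ⟪ S ⟫ x                                             ∎
    where open ≡-Reasoning

  Vertexᵇ-actSub : ∀ g S → Vertexᵇ (actSub g S) ≡ Vertexᵇ S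
  Vertexᵇ-actSub g S = cong (λ k → (0 <ᵇ k) ∧ (k <ᵇ n)) (∣permute∣ (induced g) S)

  chainᵇ-actSub : ∀ g F → chainᵇ (map (actSub g) F) ≡ chainᵇ F
  chainᵇ-actSub g []           = refl
  chainᵇ-actSub g (S ∷ [])     = refl
  chainᵇ-actSub g (S ∷ S' ∷ F) = cong₂ _∧_ (⊂?-permute (induced g) S S') (chainᵇ-actSub g (S' ∷ F))

  IsFlagᵇ-actSub : ∀ g F → IsFlagᵇ (map (actSub g) F) ≡ IsFlagᵇ F
  IsFlagᵇ-actSub g F = cong₂ _∧_ (all-map F) (chainᵇ-actSub g F)
    where
    all-map : ∀ F → all Vertexᵇ (map (actSub g) F) ≡ all Vertexᵇ F
    all-map []      = refl
    all-map (S ∷ F) = cong₂ _∧_ (Vertexᵇ-actSub g S) (all-map F)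

  inΣᵇ-actSub : ∀ g → Hmap g h ≡ h → ∀ F → inΣᵇ (map (actSub g) F) ≡ inΣᵇ F
  inΣᵇ-actSub g gh≡h F = begin
    φC N (map ⟪_⟫ (compOf (map (actSub g) F))) h                ≡⟨ cong (λ C → φC N (map ⟪_⟫ C) h) (trans (compOf≡composition _) (composition-permute (induced g) F)) ⟩
    φC N (map ⟪_⟫ (map (actSub g) (composition F))) h           ≡⟨ φC-invariant N h g gh≡h _ _ (related (composition F)) ⟨
    φC N (map ⟪_⟫ (composition F)) h                            ≡⟨ cong (λ C → φC N (map ⟪_⟫ C) h) (compOf≡composition F) ⟨
    φC N (map ⟪_⟫ (compOf F)) h                                 ∎
    where
    open ≡-Reasoning
    related : ∀ C → Pointwise (Related (⇑ g)) (map ⟪_⟫ C) (map ⟪_⟫ (map (actSub g) C))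
    related []      = []
    related (S ∷ C) = ⟪actSub⟫ g S ∷ related C

  actSub-isAut : ∀ g → Hmap g h ≡ h → IsAut Σφ (actSub g)
  actSub-isAut g gh≡h =
    (λ S → subst T (sym (Vertexᵇ-actSub g S))) ,
    (λ S _ → ∣permute∣ π S) ,
    (λ S S' _ _ → permute-injective π) ,
    (λ S' v → permute (flip π) S' , subst T (trans (sym (cong Vertexᵇ (permute-flip (flip π) S'))) (Vertexᵇ-actSub g (permute (flip π) S'))) v
                                  , permute-flip (flip π) S') ,
    (λ F (flag , inΣ) → map (actSub g) F ,
       (subst T (sym (IsFlagᵇ-actSub g F)) flag , subst T (sym (inΣᵇ-actSub g gh≡h F)) inΣ) , ↭-refl)
    where
    π : Permutation′ n
    π = induced g

-- Sublevel flags

module _ {n : ℕ} where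

  ∈⇒lookup : ∀ {S : Subset n} {j} → j ∈ₛ S → T (lookup S j)
  ∈⇒lookup j∈S = subst T (sym (Vec.[]=⇒lookup j∈S)) _

  lookup⇒∈ : ∀ {S : Subset n} {j} → T (lookup S j) → j ∈ₛ S
  lookup⇒∈ {S} {j} t with lookup S j in eq
  ... | true = Vec.lookup⇒[]= j S eq

  IsVertex : Subset n → Set
  IsVertex S = 0 < ∣ S ∣ × ∣ S ∣ < n

  level : (Fin n → ℕ) → ℕ → Subset n
  level ρ m = tabulate (λ j → ρ j ≡ᵇ m)

  sublevel : (Fin n → ℕ) → ℕ → Subset n
  sublevel ρ m = tabulate (λ j → ρ j <ᵇ suc m)

  lookup-sublevel : ∀ ρ m j → lookup (sublevel ρ m) j ≡ (ρ j <ᵇ suc m)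
  lookup-sublevel ρ m = Vec.lookup∘tabulate _

  sublevels : (Fin n → ℕ) → ℕ → ℕ → List (Subset n)
  sublevels ρ o zero    = []
  sublevels ρ o (suc l) = sublevel ρ o ∷ sublevels ρ (suc o) l

  sublevels-cong : ∀ ρ ρ' o l → (∀ j → ρ j ≡ ρ' j ⊎ (ρ j ≤ o × ρ' j ≤ o)) → sublevels ρ o l ≡ sublevels ρ' o l
  sublevels-cong ρ ρ' o zero    _     = refl
  sublevels-cong ρ ρ' o (suc l) agree = cong₂ _∷_ (Vec.tabulate-cong head) (sublevels-cong ρ ρ' (suc o) l agree′)
    where
    head : ∀ j → (ρ j <ᵇ suc o) ≡ (ρ' j <ᵇ suc o)
    head j with agree j
    ... | inj₁ ρj≡ρ'j           = cong (_<ᵇ suc o) ρj≡ρ'j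
    ... | inj₂ (ρj≤o , ρ'j≤o) = trans (<ᵇ-true (s≤s ρj≤o)) (sym (<ᵇ-true (s≤s ρ'j≤o)))
    agree′ : ∀ j → ρ j ≡ ρ' j ⊎ (ρ j ≤ suc o × ρ' j ≤ suc o)
    agree′ j with agree j
    ... | inj₁ ρj≡ρ'j           = inj₁ ρj≡ρ'j
    ... | inj₂ (ρj≤o , ρ'j≤o) = inj₂ (m≤n⇒m≤1+n ρj≤o , m≤n⇒m≤1+n ρ'j≤o)

  sublevels-permute : ∀ (π : Permutation′ n) ρ o l → map (permute π) (sublevels ρ o l) ≡ sublevels (ρ ∘ (π ⟨$⟩ʳ_)) o l
  sublevels-permute π ρ o zero    = refl
  sublevels-permute π ρ o (suc l) =
    cong₂ _∷_ (Vec.tabulate-cong (λ j → lookup-sublevel ρ o (π ⟨$⟩ʳ j))) (sublevels-permute π ρ (suc o) l)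

  -- rank F j is length F when no member of F contains j
  rank : List (Subset n) → Fin n → ℕ
  rank []      j = 0
  rank (S ∷ F) j = if lookup S j then 0 else suc (rank F j)

  rank-≤ : ∀ F j → rank F j ≤ length F
  rank-≤ []      j = z≤n
  rank-≤ (S ∷ F) j with lookup S j
  ... | true  = z≤n
  ... | false = s≤s (rank-≤ F j)

  rank-permute : ∀ (π : Permutation′ n) F j → rank (map (permute π) F) j ≡ rank F (π ⟨$⟩ʳ j)
  rank-permute π []      j = refl
  rank-permute π (S ∷ F) j rewrite lookup-permute π S j | rank-permute π F j = refl

  rank-sublevels : ∀ ρ o l j → ρ j ≤ o + l → rank (sublevels ρ o l) j ≡ ρ j ∸ o
  rank-sublevels ρ o zero    j ρj≤o   = sym (m≤n⇒m∸n≡0 (≤-trans ρj≤o (≤-reflexive (+-identityʳ o))))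
  rank-sublevels ρ o (suc l) j ρj≤o+l rewrite lookup-sublevel ρ o j with ρ j <ᵇ suc o in eq
  ... | true  = sym (m≤n⇒m∸n≡0 (s≤s⁻¹ (<ᵇ⇒< (ρ j) (suc o) (subst T (sym eq) _))))
  ... | false = trans (cong suc (rank-sublevels ρ (suc o) l j (≤-trans ρj≤o+l (≤-reflexive (+-suc o l)))))
                      (sym (+-∸-assoc 1 {ρ j} {suc o} (≰⇒> λ ρj≤o → subst T eq (<⇒<ᵇ (s≤s ρj≤o)))))

  rank-tail-≡0 : ∀ S F j → Linked _⊂_ (S ∷ F) → T (lookup S j) → rank F j ≡ 0
  rank-tail-≡0 S []       j _              _ = refl
  rank-tail-≡0 S (S' ∷ F) j ((S⊆S' , _) ∷ _) j∈S with lookup S' j in eq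
  ... | true  = refl
  ... | false = ⊥-elim (subst T eq (∈⇒lookup (S⊆S' (lookup⇒∈ j∈S))))

  sublevels-rank : ∀ F o → Linked _⊂_ F → sublevels (λ j → o + rank F j) o (length F) ≡ F
  sublevels-rank []      o _       = refl
  sublevels-rank (S ∷ F) o linked = cong₂ _∷_ head tail
    where
    ρ : Fin n → ℕ
    ρ j = o + rank (S ∷ F) j
    head : sublevel ρ o ≡ S
    head = Vec-≡ λ j → trans (lookup-sublevel ρ o j) (head′ j)
      where
      head′ : ∀ j → (ρ j <ᵇ suc o) ≡ lookup S j
      head′ j with lookup S j
      ... | true  = <ᵇ-true (s≤s (≤-reflexive (+-identityʳ o)))
      ... | false = <ᵇ-false (≤-trans (m≤m+n (suc o) (rank F j)) (≤-reflexive (sym (+-suc o (rank F j)))))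
    agree : ∀ j → ρ j ≡ suc o + rank F j ⊎ (ρ j ≤ suc o × suc o + rank F j ≤ suc o)
    agree j with lookup S j in eq
    ... | true  = inj₂ (≤-trans (≤-reflexive (+-identityʳ o)) (n≤1+n o) ,
                        ≤-reflexive (trans (cong (suc o +_) (rank-tail-≡0 S F j linked (subst T (sym eq) _))) (+-identityʳ (suc o))))
    ... | false = inj₁ (+-suc o (rank F j))
    tail : sublevels ρ (suc o) (length F) ≡ F
    tail = trans (sublevels-cong ρ (λ j → suc o + rank F j) (suc o) (length F) agree) (sublevels-rank F (suc o) (Linked.tail linked))

  lookup-─ : ∀ (A B : Subset n) j → lookup (A ─ B) j ≡ (lookup A j ∧ not (lookup B j))
  lookup-─ A B j = lookup-zipWith-diff _ (λ _ → refl) (λ _ → refl) A B j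
    where
    -- _─_ is zipWith of a function local to its definition; these two equations characterise it
    lookup-zipWith-diff : ∀ (diff : Bool → Bool → Bool) → (∀ a → diff a true ≡ false) → (∀ a → diff a false ≡ a) →
                          ∀ (A B : Subset n) j → lookup (zipWith diff A B) j ≡ (lookup A j ∧ not (lookup B j))
    lookup-zipWith-diff diff diff-true diff-false A B j with lookup B j | Vec.lookup-zipWith diff j A B
    ... | true  | eq = trans eq (trans (diff-true _) (sym (∧-zeroʳ (lookup A j))))
    ... | false | eq = trans eq (trans (diff-false _) (sym (∧-identityʳ (lookup A j))))

  composition-blocks-sublevels : ∀ ρ o l → (∀ j → ρ j ≤ suc o + l) →
    composition-blocks (sublevel ρ o) (sublevels ρ (suc o) l) ≡ map (level ρ) (iterate suc (suc o) (suc l))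
  composition-blocks-sublevels ρ o zero    ρ≤ = cong (_∷ []) (Vec-≡ λ j → begin
    lookup (∁ (sublevel ρ o)) j           ≡⟨ Vec.lookup-map j not (sublevel ρ o) ⟩
    not (lookup (sublevel ρ o) j)         ≡⟨ cong not (lookup-sublevel ρ o j) ⟩
    not (ρ j <ᵇ suc o)                    ≡⟨ ≮ᵇ⇒≡ᵇ (ρ j) (suc o) (≤-trans (ρ≤ j) (≤-reflexive (+-identityʳ (suc o)))) ⟩
    (ρ j ≡ᵇ suc o)                        ≡⟨ Vec.lookup∘tabulate _ j ⟨
    lookup (level ρ (suc o)) j            ∎)
    where open ≡-Reasoning
  composition-blocks-sublevels ρ o (suc l) ρ≤ = cong₂ _∷_ (Vec-≡ λ j → begin
    lookup (sublevel ρ (suc o) ─ sublevel ρ o) j                  ≡⟨ lookup-─ (sublevel ρ (suc o)) (sublevel ρ o) j ⟩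
    lookup (sublevel ρ (suc o)) j ∧ not (lookup (sublevel ρ o) j) ≡⟨ cong₂ (λ a b → a ∧ not b) (lookup-sublevel ρ (suc o) j) (lookup-sublevel ρ o j) ⟩
    (ρ j <ᵇ suc (suc o)) ∧ not (ρ j <ᵇ suc o)                     ≡⟨ <ᵇsuc∧≮ᵇ≡≡ᵇ (ρ j) (suc o) ⟩
    (ρ j ≡ᵇ suc o)                                                ≡⟨ Vec.lookup∘tabulate _ j ⟨
    lookup (level ρ (suc o)) j                                    ∎)
    (composition-blocks-sublevels ρ (suc o) l (λ j → ≤-trans (ρ≤ j) (≤-reflexive (+-suc (suc o) l))))
    where open ≡-Reasoning

  composition-sublevels : ∀ ρ k → (∀ j → ρ j ≤ k) → composition (sublevels ρ 0 k) ≡ map (level ρ) (iterate suc 0 (suc k))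
  composition-sublevels ρ zero    ρ≤ = cong (_∷ []) (Vec-≡ λ j →
    trans (Vec.lookup-replicate j true) (trans (≮ᵇ⇒≡ᵇ (ρ j) 0 (ρ≤ j)) (sym (Vec.lookup∘tabulate _ j))))
  composition-sublevels ρ (suc k) ρ≤ = cong₂ _∷_
    (Vec-≡ λ j → trans (lookup-sublevel ρ 0 j) (trans (<ᵇ1≡≡ᵇ0 (ρ j)) (sym (Vec.lookup∘tabulate _ j))))
    (composition-blocks-sublevels ρ 0 k ρ≤)

-- gaps n 0 (s₁ ∷ ⋯ ∷ s_k ∷ []) is the paper's α({s₁, …, s_k}) before its zero parts are dropped
gaps : ℕ → ℕ → List ℕ → List ℕ
gaps n prev []       = (n ∸ prev) ∷ []
gaps n prev (s ∷ ss) = (s ∸ prev) ∷ gaps n s ss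

module _ {n : ℕ} where

  ∣sublevel∣ : ∀ (ρ : Fin n → ℕ) m → ∣ sublevel ρ m ∣ ≡ countF (λ j → ρ j <ᵇ suc m)
  ∣sublevel∣ ρ m = trans (∣∣≡countF (sublevel ρ m)) (countF-cong (lookup-sublevel ρ m))

  gaps-sublevels : ∀ (ρ : Fin n → ℕ) o l → (∀ j → ρ j ≤ o + l) →
    gaps n (countF (λ j → ρ j <ᵇ o)) (map ∣_∣ (sublevels ρ o l)) ≡ map (λ m → countF (λ j → ρ j ≡ᵇ m)) (iterate suc o (suc l))
  gaps-sublevels ρ o zero    ρ≤ = cong (_∷ []) (begin
    n ∸ below                                             ≡⟨ cong (_∸ below) (countF-complement (λ j → ρ j <ᵇ o)) ⟨
    below + countF (λ j → not (ρ j <ᵇ o)) ∸ below         ≡⟨ m+n∸m≡n below _ ⟩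
    countF (λ j → not (ρ j <ᵇ o))                         ≡⟨ countF-cong (λ j → ≮ᵇ⇒≡ᵇ (ρ j) o (≤-trans (ρ≤ j) (≤-reflexive (+-identityʳ o)))) ⟩
    countF (λ j → ρ j ≡ᵇ o)                               ∎)
    where
    open ≡-Reasoning
    below : ℕ
    below = countF (λ j → ρ j <ᵇ o)
  gaps-sublevels ρ o (suc l) ρ≤ = cong₂ _∷_
    (begin
      ∣ sublevel ρ o ∣ ∸ below                            ≡⟨ cong (_∸ below) (∣sublevel∣ ρ o) ⟩
      countF (λ j → ρ j <ᵇ suc o) ∸ below                 ≡⟨ cong (_∸ below) (countF-+ _ _ _ (λ j → indicator-<ᵇsuc (ρ j) o)) ⟩
      below + countF (λ j → ρ j ≡ᵇ o) ∸ below             ≡⟨ m+n∸m≡n below _ ⟩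
      countF (λ j → ρ j ≡ᵇ o)                             ∎)
    (trans (cong (λ s → gaps n s (map ∣_∣ (sublevels ρ (suc o) l))) (∣sublevel∣ ρ o))
           (gaps-sublevels ρ (suc o) l (λ j → ≤-trans (ρ≤ j) (≤-reflexive (+-suc o l)))))
    where
    open ≡-Reasoning
    below : ℕ
    below = countF (λ j → ρ j <ᵇ o)

  ∉⇒lookup≡false : ∀ {S : Subset n} {j} → j ∉ₛ S → lookup S j ≡ false
  ∉⇒lookup≡false {S} {j} j∉S with lookup S j in eq
  ... | true  = ⊥-elim (j∉S (lookup⇒∈ (subst T (sym eq) _)))
  ... | false = refl

  rank-∷-∈ : ∀ (S : Subset n) F j → T (lookup S j) → rank (S ∷ F) j ≡ 0
  rank-∷-∈ S F j j∈S with lookup S j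
  ... | true = refl

  rank-∷-∉ : ∀ (S : Subset n) F j → lookup S j ≡ false → rank (S ∷ F) j ≡ suc (rank F j)
  rank-∷-∉ S F j j∉S rewrite j∉S = refl

  rank-attains : Fin n → ∀ F → Linked _⊂_ F → All IsVertex F → ∀ m → m ≤ length F → ∃[ j ] rank F j ≡ m
  rank-attains j₀ []           _ _ zero _ = j₀ , refl
  rank-attains j₀ (S ∷ F)      _ ((0<∣S∣ , _) ∷ _) zero _ =
    let (j , j∈S) = countF-witness (lookup S) (subst (0 <_) (∣∣≡countF S) 0<∣S∣) in j , rank-∷-∈ S F j j∈S
  rank-attains j₀ (S ∷ [])     _ ((_ , ∣S∣<n) ∷ _) (suc zero) _ =
    let (j , j∉S) = countF-witness (not ∘ lookup S) (complement-positive S ∣S∣<n) in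
    j , rank-∷-∉ S [] j (not-T j∉S)
    where
    not-T : ∀ {b} → T (not b) → b ≡ false
    not-T {false} _ = refl
    complement-positive : ∀ S → ∣ S ∣ < n → 0 < countF (not ∘ lookup S)
    complement-positive S ∣S∣<n = subst (0 <_) count-complement (m<n⇒0<n∸m (subst (_< n) (∣∣≡countF S) ∣S∣<n))
      where
      count-complement : n ∸ countF (lookup S) ≡ countF (not ∘ lookup S)
      count-complement = trans (cong (_∸ countF (lookup S)) (sym (countF-complement (lookup S)))) (m+n∸m≡n (countF (lookup S)) _)
  rank-attains j₀ (S ∷ [])     _ _ (suc (suc m)) (s≤s ())
  rank-attains j₀ (S ∷ S' ∷ F) ((_ , x , x∈S' , x∉S) ∷ _) _ (suc zero) _ =
    x , trans (rank-∷-∉ S (S' ∷ F) x (∉⇒lookup≡false x∉S)) (cong suc (rank-∷-∈ S' F x (∈⇒lookup x∈S')))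
  rank-attains j₀ (S ∷ S' ∷ F) ((S⊆S' , _) ∷ linked) (_ ∷ vertices) (suc (suc m)) (s≤s m≤) =
    let (j , rank≡) = rank-attains j₀ (S' ∷ F) linked vertices (suc m) m≤
        j∉S' = head-false j (subst (0 <_) (sym rank≡) (s≤s z≤n))
    in j , trans (rank-∷-∉ S (S' ∷ F) j (∉⇒lookup≡false (j∉S' ∘ S⊆S'))) (cong suc rank≡)
    where
    head-false : ∀ j → 0 < rank (S' ∷ F) j → j ∉ₛ S'
    head-false j 0<rank j∈S' with lookup S' j | ∈⇒lookup j∈S'
    ... | true | _ = <-irrefl refl 0<rank

  countF-< : ∀ (Q : Fin n → Bool) j → Q j ≡ false → countF Q < n
  countF-< Q j Qj≡false = subst (countF Q <_) (countF-complement Q)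
    (m<m+n (countF Q) (countF-positive (not ∘ Q) j (subst (T ∘ not) (sym Qj≡false) _)))

  module _ (ρ : Fin n → ℕ) (k : ℕ) (attained : ∀ m → m ≤ k → ∃[ j ] ρ j ≡ m) where

    sublevel-isVertex : ∀ m → m < k → IsVertex (sublevel ρ m)
    sublevel-isVertex m m<k =
      subst (0 <_) (sym (∣sublevel∣ ρ m)) (countF-positive _ j₀ (subst (λ r → T (r <ᵇ suc m)) (sym ρj₀≡0) _)) ,
      subst (_< n) (sym (∣sublevel∣ ρ m)) (countF-< _ jₖ (<ᵇ-false (≤-trans m<k (≤-reflexive (sym ρjₖ≡k)))))
      where
      j₀ = proj₁ (attained 0 z≤n)
      ρj₀≡0 = proj₂ (attained 0 z≤n)
      jₖ = proj₁ (attained k ≤-refl)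
      ρjₖ≡k = proj₂ (attained k ≤-refl)

    sublevel-⊂ : ∀ o → suc o ≤ k → sublevel ρ o ⊂ sublevel ρ (suc o)
    sublevel-⊂ o o<k = sublevel-⊆ , x , x∈ , x∉
      where
      sublevel-⊆ : sublevel ρ o ⊆ sublevel ρ (suc o)
      sublevel-⊆ {j} j∈ = lookup⇒∈ (subst T (sym (lookup-sublevel ρ (suc o) j))
        (<⇒<ᵇ (m≤n⇒m≤1+n (<ᵇ⇒< (ρ j) (suc o) (subst T (lookup-sublevel ρ o j) (∈⇒lookup j∈))))))
      x = proj₁ (attained (suc o) o<k)
      ρx≡1+o = proj₂ (attained (suc o) o<k)
      x∈ : x ∈ₛ sublevel ρ (suc o)
      x∈ = lookup⇒∈ (subst T (sym (trans (lookup-sublevel ρ (suc o) x) (cong (_<ᵇ suc (suc o)) ρx≡1+o))) (<⇒<ᵇ (≤-refl {suc (suc o)})))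
      x∉ : x ∉ₛ sublevel ρ o
      x∉ x∈′ = subst T (trans (lookup-sublevel ρ o x) (<ᵇ-false (≤-reflexive (sym ρx≡1+o)))) (∈⇒lookup x∈′)

    sublevels-isFlag : ∀ o l → o + l ≤ k → Linked _⊂_ (sublevels ρ o l) × All IsVertex (sublevels ρ o l)
    sublevels-isFlag o zero          _      = [] , []
    sublevels-isFlag o (suc zero)    o+1≤k  = [-] , sublevel-isVertex o (≤-trans (≤-reflexive (+-comm 1 o)) o+1≤k) ∷ []
    sublevels-isFlag o (suc (suc l)) o+l≤k  =
      let o+l≤k′ = ≤-trans (≤-reflexive (sym (+-suc o (suc l)))) o+l≤k
          o<k = ≤-trans (s≤s (m≤m+n o (suc l))) o+l≤k′
          (linked , vertices) = sublevels-isFlag (suc o) (suc l) o+l≤k′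
      in sublevel-⊂ o o<k ∷ linked , sublevel-isVertex o o<k ∷ vertices

  flag-length : ∀ S F → Linked _⊂_ (S ∷ F) → All IsVertex (S ∷ F) → ∣ S ∣ + length (S ∷ F) ≤ n
  flag-length S []       _                   ((_ , ∣S∣<n) ∷ _) = ≤-trans (≤-reflexive (+-comm ∣ S ∣ 1)) ∣S∣<n
  flag-length S (S' ∷ F) (S⊂S' ∷ linked) (_ ∷ vertices) = begin
    ∣ S ∣ + suc (length (S' ∷ F))   ≡⟨ +-suc ∣ S ∣ _ ⟩
    suc ∣ S ∣ + length (S' ∷ F)     ≤⟨ +-monoˡ-≤ _ (p⊂q⇒∣p∣<∣q∣ S⊂S') ⟩
    ∣ S' ∣ + length (S' ∷ F)        ≤⟨ flag-length S' F linked vertices ⟩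
    n                               ∎
    where open ≤-Reasoning

  flag-length-≤ : ∀ F → Linked _⊂_ F → All IsVertex F → length F ≤ n
  flag-length-≤ []      _      _        = z≤n
  flag-length-≤ (S ∷ F) linked vertices = ≤-trans (m≤n+m _ ∣ S ∣) (flag-length S F linked vertices)

-- Colorings and flags

module FlagFacts (Hp : LinHopf) (χ : Character Hp) (N : FinSet) (h : LinHopf.H Hp N) where
  open Theory Hp χ
  open OnSet N h

  positive : ℕ → Bool
  positive k = 0 <ᵇ k

  positive-false⇒≡0 : ∀ x → positive x ≡ false → x ≡ 0
  positive-false⇒≡0 zero _ = refl

  -- as for compOf, the local helper of alpha is reached through alpha of the tail, whose head survives the filter
  alpha≡gaps : ∀ F → All (λ S → 0 < ∣ S ∣) F → alpha F ≡ filterᵇ positive (gaps n 0 (map ∣_∣ F))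
  alpha≡gaps []           _                       = refl
  alpha≡gaps (S ∷ [])     _                       = refl
  alpha≡gaps (S ∷ G ∷ Gs) (_ ∷ 0<∣G∣ ∷ positives) =
    filterᵇ-∷-cong positive (∣ S ∣ ∸ 0) (filterᵇ-∷-cong positive (∣ G ∣ ∸ ∣ S ∣)
      (filterᵇ-∷-cancel positive (∣ G ∣ ∸ 0) (<⇒<ᵇ 0<∣G∣) (alpha≡gaps (G ∷ Gs) (0<∣G∣ ∷ positives))))

  chainᵇ⇒Linked : ∀ F → T (chainᵇ F) → Linked _⊂_ F
  chainᵇ⇒Linked []           _ = []
  chainᵇ⇒Linked (S ∷ [])     _ = [-]
  chainᵇ⇒Linked (S ∷ S' ∷ F) t =
    toWitness {a? = S ⊂? S'} (proj₁ (to (T-∧ {⌊ S ⊂? S' ⌋}) t)) ∷ chainᵇ⇒Linked (S' ∷ F) (proj₂ (to (T-∧ {⌊ S ⊂? S' ⌋}) t))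

  Linked⇒chainᵇ : ∀ F → Linked _⊂_ F → T (chainᵇ F)
  Linked⇒chainᵇ []           _               = _
  Linked⇒chainᵇ (S ∷ [])     _               = _
  Linked⇒chainᵇ (S ∷ S' ∷ F) (S⊂S' ∷ linked) = from T-∧ (fromWitness S⊂S' , Linked⇒chainᵇ (S' ∷ F) linked)

  Vertexᵇ⇒IsVertex : ∀ S → Vertex S → IsVertex S
  Vertexᵇ⇒IsVertex S t = <ᵇ⇒< 0 (∣ S ∣) (proj₁ (to T-∧ t)) , <ᵇ⇒< (∣ S ∣) n (proj₂ (to (T-∧ {0 <ᵇ ∣ S ∣}) t))

  IsVertex⇒Vertexᵇ : ∀ S → IsVertex S → Vertex S
  IsVertex⇒Vertexᵇ S (0<∣S∣ , ∣S∣<n) = from T-∧ (<⇒<ᵇ 0<∣S∣ , <⇒<ᵇ ∣S∣<n)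

  IsFlagᵇ⇒ : ∀ F → T (IsFlagᵇ F) → Linked _⊂_ F × All IsVertex F
  IsFlagᵇ⇒ F t = chainᵇ⇒Linked F (proj₂ (to (T-∧ {all Vertexᵇ F}) t)) ,
                 All.map (λ {S} → Vertexᵇ⇒IsVertex S) (T-all⁻ Vertexᵇ F (proj₁ (to T-∧ t)))

  IsFlagᵇ⇐ : ∀ F → Linked _⊂_ F → All IsVertex F → T (IsFlagᵇ F)
  IsFlagᵇ⇐ F linked vertices = from T-∧ (T-all⁺ Vertexᵇ (All.map (λ {S} → IsVertex⇒Vertexᵇ S) vertices) , Linked⇒chainᵇ F linked)

  values≡ : ∀ (f : Carrier N → ℕ) K → (∀ v → f v < K) →
            values f ≡ map toℕ (filterᵇ (λ i → positive (fiber f (toℕ i))) (allFin K))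
  values≡ f K f<K = begin
    filterᵇ attained (upTo (suc M))                       ≡⟨ filterᵇ-upTo attained (suc M) K attained<1+M attained<K ⟩
    filterᵇ attained (upTo K)                             ≡⟨ cong (filterᵇ attained) (upTo≡map-toℕ-allFin K) ⟩
    filterᵇ attained (map toℕ (allFin K))                 ≡⟨ filterᵇ-map attained toℕ (allFin K) ⟩
    map toℕ (filterᵇ (attained ∘ toℕ) (allFin K))         ≡⟨ cong (map toℕ) (filterᵇ-cong (λ i → any≡0<ᵇcountᵇ _ (allFin n)) (allFin K)) ⟩
    map toℕ (filterᵇ (λ i → positive (fiber f (toℕ i))) (allFin K))   ∎
    where
    open ≡-Reasoning
    attained : ℕ → Bool
    attained i = any (λ j → f (elt j) ≡ᵇ i) (allFin n)
    M : ℕ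
    M = foldr _⊔_ 0 (map (f ∘ elt) (allFin n))
    witness : ∀ i → T (attained i) → ∃[ j ] f (elt j) ≡ i
    witness i t =
      let (j , t′) = countF-witness (λ j → f (elt j) ≡ᵇ i)
                       (subst (0 <_) (countᵇ-allFin (λ j → f (elt j) ≡ᵇ i))
                         (<ᵇ⇒< 0 _ (subst T (any≡0<ᵇcountᵇ (λ j → f (elt j) ≡ᵇ i) (allFin n)) t)))
      in j , ≡ᵇ⇒≡ _ _ t′
    attained<1+M : ∀ i → T (attained i) → i < suc M
    attained<1+M i t with witness i t
    ... | j , refl = s≤s (≤-foldr-⊔ (map (f ∘ elt) (allFin n)) (∈-map⁺ (f ∘ elt) (∈-allFin j)))
    attained<K : ∀ i → T (attained i) → i < K
    attained<K i t with witness i t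
    ... | j , refl = f<K (elt j)

module Coefficients (Hp : LinHopf) (χ : Character Hp) (N : FinSet) (h : LinHopf.H Hp N)
                    (g : Bij N N) (K : ℕ) (e : Fin K → ℕ) where
  open LinHopf Hp
  open Character χ
  open Theory Hp χ
  open OnSet N h
  open Transport Hp χ
  open Automorphism Hp χ N h
  open FlagFacts Hp χ N h
  open Increasing {Fin K} toℕ

  support : List (Fin K)
  support = filterᵇ (positive ∘ e) (allFin K)

  support-increasing : Increasing support
  support-increasing = AllPairs.filter⁺ (T? ∘ positive ∘ e) (AllPairs.tabulate⁺-< (λ i<j → i<j))

  ∈-support⁺ : ∀ i → T (positive (e i)) → i ∈ support
  ∈-support⁺ i = ∈-filter⁺ (T? ∘ positive ∘ e) (∈-allFin i)

  ∈-support⁻ : ∀ {i} → i ∈ support → T (positive (e i))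
  ∈-support⁻ i∈ = proj₂ (∈-filter⁻ (T? ∘ positive ∘ e) {xs = allFin K} i∈)

  nonzeros≡map-support : nonzeros e ≡ map e support
  nonzeros≡map-support = filterᵇ-map positive e (allFin K)

  color : Vec (Fin K) n → Carrier N → ℕ
  color w v = toℕ (lookup w (Inverse.to (enum N) v))

  colorCount : Vec (Fin K) n → ℕ → ℕ
  colorCount w i = countF (λ j → toℕ (lookup w j) ≡ᵇ i)

  fiber-color : ∀ w i → fiber (color w) i ≡ colorCount w i
  fiber-color w i = trans (countᵇ-allFin (λ j → color w (elt j) ≡ᵇ i))
    (countF-cong λ j → cong (λ j′ → toℕ (lookup w j′) ≡ᵇ i) (strictlyInverseˡ (enum N) j))

  π : Permutation′ n
  π = induced g

  record ValidColoring (w : Vec (Fin K) n) : Set where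
    field
      proper : T (properᵇ (color w))
      fixed  : ∀ j → lookup w (π ⟨$⟩ʳ j) ≡ lookup w j
      counts : ∀ i → colorCount w (toℕ i) ≡ e i

  record ValidFlag (F : List (Subset n)) : Set where
    field
      linked   : Linked _⊂_ F
      vertices : All IsVertex F
      inΣ      : T (inΣᵇ F)
      fixed    : map (actSub g) F ≡ F
      shape    : nonzeros e ≡ alpha F

  -- isValidColoring and isValidFlag are, definitionally, the predicates counted by Ψcoef and Fcoef.
  isValidColoring : Vec (Fin K) n → Bool
  isValidColoring w = properᵇ (color w) ∧ fixedFunᵇ g (color w) ∧ all (λ i → fiber (color w) (toℕ i) ≡ᵇ e i) (allFin K)

  isValidFlag : List (Subset n) → Bool
  isValidFlag F = IsFlagᵇ F ∧ inΣᵇ F ∧ (map (actSub g) F ==Ss F) ∧ (nonzeros e ==ℕs alpha F)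

  validColoring⁻ : ∀ w → T (isValidColoring w) → ValidColoring w
  validColoring⁻ w t with to T-∧ t
  ... | proper , rest with to (T-∧ {fixedFunᵇ g (color w)}) rest
  ... | fixedᵇ , countsᵇ = record
    { proper = proper
    ; fixed  = λ j → toℕ-injective (trans (≡ᵇ⇒≡ _ _ (All.lookup (T-all⁻ _ (allFin n) fixedᵇ) (∈-allFin j)))
                                          (cong (toℕ ∘ lookup w) (strictlyInverseˡ (enum N) j)))
    ; counts = λ i → trans (sym (fiber-color w (toℕ i))) (≡ᵇ⇒≡ _ _ (All.lookup (T-all⁻ _ (allFin K) countsᵇ) (∈-allFin i)))
    }

  validColoring⁺ : ∀ w → ValidColoring w → T (isValidColoring w)
  validColoring⁺ w valid = from T-∧ (proper , from (T-∧ {fixedFunᵇ g (color w)}) (fixedᵇ , countsᵇ))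
    where
    open ValidColoring valid
    fixedᵇ = T-all⁺ _ {allFin n} (All.tabulate λ {j} _ → ≡⇒≡ᵇ _ _
               (cong toℕ (trans (fixed j) (cong (lookup w) (sym (strictlyInverseˡ (enum N) j))))))
    countsᵇ = T-all⁺ _ {allFin K} (All.tabulate λ {i} _ → ≡⇒≡ᵇ _ _ (trans (fiber-color w (toℕ i)) (counts i)))

  validFlag⁻ : ∀ F → T (isValidFlag F) → ValidFlag F
  validFlag⁻ F t with to (T-∧ {IsFlagᵇ F}) t
  ... | flag , rest with to (T-∧ {inΣᵇ F}) rest
  ... | inΣ , rest′ with to (T-∧ {map (actSub g) F ==Ss F} {nonzeros e ==ℕs alpha F}) rest′
  ... | fixedᵇ , shapeᵇ = record
    { linked   = proj₁ (IsFlagᵇ⇒ F flag)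
    ; vertices = proj₂ (IsFlagᵇ⇒ F flag)
    ; inΣ      = inΣ
    ; fixed    = toWitness fixedᵇ
    ; shape    = toWitness shapeᵇ
    }

  validFlag⁺ : ∀ F → ValidFlag F → T (isValidFlag F)
  validFlag⁺ F valid = from T-∧ (IsFlagᵇ⇐ F linked vertices , from T-∧ (inΣ ,
    from (T-∧ {map (actSub g) F ==Ss F} {nonzeros e ==ℕs alpha F}) (fromWitness fixed , fromWitness shape)))
    where open ValidFlag valid

  levelSize : (Fin n → ℕ) → ℕ → ℕ
  levelSize ρ m = countF (λ j → ρ j ≡ᵇ m)

  alpha-sublevels : ∀ ρ k → (∀ j → ρ j ≤ k) → All (λ S → 0 < ∣ S ∣) (sublevels ρ 0 k) →
                    alpha (sublevels ρ 0 k) ≡ filterᵇ positive (map (levelSize ρ) (iterate suc 0 (suc k)))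
  alpha-sublevels ρ k ρ≤k nonempty = begin
    alpha (sublevels ρ 0 k)                                                ≡⟨ alpha≡gaps _ nonempty ⟩
    filterᵇ positive (gaps n 0 (map ∣_∣ (sublevels ρ 0 k)))                ≡⟨ cong (λ c → filterᵇ positive (gaps n c (map ∣_∣ (sublevels ρ 0 k)))) none-below-0 ⟨
    filterᵇ positive (gaps n (countF (λ j → ρ j <ᵇ 0)) (map ∣_∣ (sublevels ρ 0 k)))
                                                                           ≡⟨ cong (filterᵇ positive) (gaps-sublevels ρ 0 k ρ≤k) ⟩
    filterᵇ positive (map (levelSize ρ) (iterate suc 0 (suc k)))           ∎
    where
    open ≡-Reasoning
    none-below-0 : countF (λ j → ρ j <ᵇ 0) ≡ 0
    none-below-0 = countF-const-false (λ j → ρ j <ᵇ 0) (λ _ → refl)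

  module Factored (w : Vec (Fin K) n) (ρ : Fin n → ℕ) (k : ℕ) (d : Fin K)
                  (|support|≡1+k : length support ≡ suc k)
                  (w≡nth∘ρ : ∀ j → lookup w j ≡ nth support (ρ j) d) (ρ≤k : ∀ j → ρ j ≤ k) where

    levels : List ℕ
    levels = iterate suc 0 (suc k)

    colorBlock : ℕ → Carrier N → Bool
    colorBlock m v = color w v ≡ᵇ toℕ (nth support m d)

    <|support| : ∀ {m} → m ≤ k → m < length support
    <|support| m≤k = ≤-trans (s≤s m≤k) (≤-reflexive (sym |support|≡1+k))

    nth-≡ᵇ : ∀ a m → a ≤ k → m ≤ k → (toℕ (nth support a d) ≡ᵇ toℕ (nth support m d)) ≡ (a ≡ᵇ m)
    nth-≡ᵇ a m a≤k m≤k = Bool-ext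
      (λ t → ≡⇒≡ᵇ a m (nth-injective support a m d support-increasing (<|support| a≤k) (<|support| m≤k) (toℕ-injective (≡ᵇ⇒≡ _ _ t))))
      (λ t → ≡⇒≡ᵇ _ _ (cong (λ a′ → toℕ (nth support a′ d)) (≡ᵇ⇒≡ a m t)))
      where
      Bool-ext : ∀ {a b : Bool} → (T a → T b) → (T b → T a) → a ≡ b
      Bool-ext {true}  {true}  _   _   = refl
      Bool-ext {true}  {false} a⇒b _   = ⊥-elim (a⇒b _)
      Bool-ext {false} {true}  _   b⇒a = ⊥-elim (b⇒a _)
      Bool-ext {false} {false} _   _   = refl

    colorCount-nth : ∀ m → m ≤ k → colorCount w (toℕ (nth support m d)) ≡ levelSize ρ m
    colorCount-nth m m≤k = countF-cong λ j → trans (cong (λ c → toℕ c ≡ᵇ toℕ (nth support m d)) (w≡nth∘ρ j)) (nth-≡ᵇ (ρ j) m (ρ≤k j) m≤k)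

    colorCount-outside : ∀ i → positive (e i) ≡ false → colorCount w (toℕ i) ≡ 0
    colorCount-outside i outside = countF-const-false _ never
      where
      never : ∀ j → (toℕ (lookup w j) ≡ᵇ toℕ i) ≡ false
      never j with toℕ (lookup w j) ≡ᵇ toℕ i in eq
      ... | false = refl
      ... | true  = ⊥-elim (subst T outside (subst (T ∘ positive ∘ e) (toℕ-injective (≡ᵇ⇒≡ _ _ (subst T (sym eq) _)))
                      (∈-support⁻ (subst (_∈ support) (sym (w≡nth∘ρ j)) (nth-∈ support (ρ j) d (<|support| (ρ≤k j)))))))

    support≡nth : support ≡ map (λ m → nth support m d) levels
    support≡nth = trans (sym (map-nth support d)) (cong (λ l → map (λ m → nth support m d) (iterate suc 0 l)) |support|≡1+k)

    Cf-color : (∀ i → colorCount w (toℕ i) ≡ e i) → Cf (color w) ≡ map colorBlock levels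
    Cf-color counts = begin
      map block (values (color w))                                                       ≡⟨ cong (map block) (values≡ (color w) K (λ v → toℕ<n _)) ⟩
      map block (map toℕ (filterᵇ (λ i → positive (fiber (color w) (toℕ i))) (allFin K))) ≡⟨ cong (map block ∘ map toℕ) (filterᵇ-cong colorCount≡ (allFin K)) ⟩
      map block (map toℕ support)                                                        ≡⟨ cong (map block ∘ map toℕ) support≡nth ⟩
      map block (map toℕ (map (λ m → nth support m d) levels))                           ≡⟨ trans (map-∘ levels) (cong (map block) (map-∘ levels)) ⟨
      map colorBlock levels                                                              ∎
      where
      open ≡-Reasoning
      block : ℕ → Carrier N → Bool
      block i v = color w v ≡ᵇ i
      colorCount≡ : ∀ i → positive (fiber (color w) (toℕ i)) ≡ positive (e i)
      colorCount≡ i = cong positive (trans (fiber-color w (toℕ i)) (counts i))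

    proper≡inΣ : (∀ i → colorCount w (toℕ i) ≡ e i) → properᵇ (color w) ≡ inΣᵇ (sublevels ρ 0 k)
    proper≡inΣ counts = begin
      φC N (Cf (color w)) h                                            ≡⟨ cong (λ C → φC N C h) (Cf-color counts) ⟩
      φC N (map colorBlock levels) h                                   ≡⟨ φC-cong N h _ _ blocks-agree ⟨
      φC N (map ⟪_⟫ (map (level ρ) levels)) h                           ≡⟨ cong (λ C → φC N (map ⟪_⟫ C) h) (composition-sublevels ρ k ρ≤k) ⟨
      φC N (map ⟪_⟫ (composition (sublevels ρ 0 k))) h                  ≡⟨ cong (λ C → φC N (map ⟪_⟫ C) h) (compOf≡composition (sublevels ρ 0 k)) ⟨
      φC N (map ⟪_⟫ (compOf (sublevels ρ 0 k))) h                       ∎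
      where
      open ≡-Reasoning
      blocks-agree : Pointwise (Related id) (map ⟪_⟫ (map (level ρ) levels)) (map colorBlock levels)
      blocks-agree = subst (λ C → Pointwise (Related id) C (map colorBlock levels)) (map-∘ levels)
        (Pointwise-map-iterate (⟪_⟫ ∘ level ρ) colorBlock 0 (suc k) λ m _ m<1+k v →
          let j = Inverse.to (enum N) v in begin
          color w v ≡ᵇ toℕ (nth support m d)                 ≡⟨ cong (λ c → toℕ c ≡ᵇ toℕ (nth support m d)) (w≡nth∘ρ j) ⟩
          toℕ (nth support (ρ j) d) ≡ᵇ toℕ (nth support m d)  ≡⟨ nth-≡ᵇ (ρ j) m (ρ≤k j) (s≤s⁻¹ m<1+k) ⟩
          ρ j ≡ᵇ m                                            ≡⟨ Vec.lookup∘tabulate (λ j′ → ρ j′ ≡ᵇ m) j ⟨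
          ⟪ level ρ m ⟫ v                                     ∎)

    map-e-support : map e support ≡ map (e ∘ λ m → nth support m d) levels
    map-e-support = trans (cong (map e) support≡nth) (sym (map-∘ levels))

    levelSizes≡ : (∀ m → m ≤ k → levelSize ρ m ≡ e (nth support m d)) → map (levelSize ρ) levels ≡ map e support
    levelSizes≡ levelSize≡ =
      trans (Pointwise-≡⇒≡ (Pointwise-map-iterate _ _ 0 (suc k) λ m _ m<1+k → levelSize≡ m (s≤s⁻¹ m<1+k))) (sym map-e-support)

    counts-from-levelSizes : (∀ m → m ≤ k → levelSize ρ m ≡ e (nth support m d)) → ∀ i → colorCount w (toℕ i) ≡ e i
    counts-from-levelSizes levelSize≡ i with positive (e i) in eq
    ... | true  = begin
      colorCount w (toℕ i)                   ≡⟨ cong (colorCount w ∘ toℕ) (nth-index support i d support-increasing i∈) ⟨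
      colorCount w (toℕ (nth support m d))   ≡⟨ colorCount-nth m m≤k ⟩
      levelSize ρ m                          ≡⟨ levelSize≡ m m≤k ⟩
      e (nth support m d)                    ≡⟨ cong e (nth-index support i d support-increasing i∈) ⟩
      e i                                    ∎
      where
      open ≡-Reasoning
      i∈ = ∈-support⁺ i (subst T (sym eq) _)
      m = index support i
      m≤k = s≤s⁻¹ (≤-trans (index-< support i support-increasing i∈) (≤-reflexive |support|≡1+k))
    ... | false = trans (colorCount-outside i eq) (sym (positive-false⇒≡0 (e i) eq))

  filterᵇ-positive-support : filterᵇ positive (map e support) ≡ map e support
  filterᵇ-positive-support = filter-all (T? ∘ positive) (All.tabulate λ x∈ →
    let (i , i∈ , x≡e-i) = ∈-map⁻ e x∈ in subst (T ∘ positive) (sym x≡e-i) (∈-support⁻ i∈))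

  top : ℕ
  top = length support ∸ 1

  |support|≡1+top : ∀ {i} → i ∈ support → length support ≡ suc top
  |support|≡1+top i∈ with support
  ... | _ ∷ _ = refl

  rankOf : Vec (Fin K) n → Fin n → ℕ
  rankOf w j = index support (lookup w j)

  -- the flag {w ≤ c₁} ⊂ ⋯ ⊂ {w ≤ c_{k-1}} for the colors c₁ < ⋯ < c_k with e cᵢ > 0
  toFlag : Vec (Fin K) n → List (Subset n)
  toFlag w = sublevels (rankOf w) 0 top

  module _ {w : Vec (Fin K) n} (valid : ValidColoring w) where
    open ValidColoring valid

    color-∈-support : ∀ j → lookup w j ∈ support
    color-∈-support j = ∈-support⁺ (lookup w j) (<⇒<ᵇ (subst (0 <_) (counts (lookup w j))
                           (countF-positive _ j (≡⇒≡ᵇ (toℕ (lookup w j)) _ refl))))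

    w≡nth∘rankOf : ∀ d j → lookup w j ≡ nth support (rankOf w j) d
    w≡nth∘rankOf d j = sym (nth-index support (lookup w j) d support-increasing (color-∈-support j))

    rankOf≤top : ∀ j → rankOf w j ≤ top
    rankOf≤top j = s≤s⁻¹ (≤-trans (index-< support (lookup w j) support-increasing (color-∈-support j))
                                  (≤-reflexive (|support|≡1+top (color-∈-support j))))

    module FactoredAt (j₀ : Fin n) =
      Factored w (rankOf w) top (lookup w j₀) (|support|≡1+top (color-∈-support j₀)) (w≡nth∘rankOf (lookup w j₀)) rankOf≤top

    toFlag-valid-at : Fin n → ValidFlag (toFlag w)
    toFlag-valid-at j₀ = record
      { linked   = proj₁ flag
      ; vertices = proj₂ flag
      ; inΣ      = subst T (proper≡inΣ counts) proper
      ; fixed    = trans (sublevels-permute π ρ 0 top)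
                         (sublevels-cong _ ρ 0 top λ j → inj₁ (cong (index support) (fixed j)))
      ; shape    = begin
          nonzeros e                                              ≡⟨ nonzeros≡map-support ⟩
          map e support                                           ≡⟨ filterᵇ-positive-support ⟨
          filterᵇ positive (map e support)                        ≡⟨ cong (filterᵇ positive) (levelSizes≡ levelSize≡) ⟨
          filterᵇ positive (map (levelSize ρ) (iterate suc 0 (suc top)))
                                                                  ≡⟨ alpha-sublevels ρ top rankOf≤top (All.map proj₁ (proj₂ flag)) ⟨
          alpha (toFlag w)                                        ∎
      }
      where
      open ≡-Reasoning
      open FactoredAt j₀
      ρ : Fin n → ℕ
      ρ = rankOf w
      d : Fin K
      d = lookup w j₀
      levelSize≡ : ∀ m → m ≤ top → levelSize ρ m ≡ e (nth support m d)
      levelSize≡ m m≤top = trans (sym (colorCount-nth m m≤top)) (counts (nth support m d))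
      attained : ∀ m → m ≤ top → ∃[ j ] ρ j ≡ m
      attained m m≤top =
        let (j , t) = countF-witness (λ j → ρ j ≡ᵇ m) (subst (0 <_) (sym (levelSize≡ m m≤top))
                        (<ᵇ⇒< 0 _ (∈-support⁻ (nth-∈ support m d (<|support| m≤top)))))
        in j , ≡ᵇ⇒≡ _ _ t
      flag : Linked _⊂_ (toFlag w) × All IsVertex (toFlag w)
      flag = sublevels-isFlag ρ top attained 0 top ≤-refl

  toFlag-injective : ∀ {w w'} → ValidColoring w → ValidColoring w' → toFlag w ≡ toFlag w' → w ≡ w'
  toFlag-injective {w} {w'} valid valid' eq = Vec-≡ λ j →
    let d = lookup w j in begin
    lookup w j                         ≡⟨ w≡nth∘rankOf valid d j ⟩
    nth support (rankOf w j) d         ≡⟨ cong (λ r → nth support r d) (rankOf≡ j) ⟩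
    nth support (rankOf w' j) d        ≡⟨ w≡nth∘rankOf valid' d j ⟨
    lookup w' j                        ∎
    where
    open ≡-Reasoning
    rankOf≡ : ∀ j → rankOf w j ≡ rankOf w' j
    rankOf≡ j = begin
      rankOf w j             ≡⟨ rank-sublevels (rankOf w) 0 top j (rankOf≤top valid j) ⟨
      rank (toFlag w) j      ≡⟨ cong (λ F → rank F j) eq ⟩
      rank (toFlag w') j     ≡⟨ rank-sublevels (rankOf w') 0 top j (rankOf≤top valid' j) ⟩
      rankOf w' j            ∎

  flag-levelSizes : ∀ {F} → ValidFlag F → Fin n → map (levelSize (rank F)) (iterate suc 0 (suc (length F))) ≡ map e support
  flag-levelSizes {F} valid j₀ = begin
    map (levelSize ρ) levels                     ≡⟨ filter-all (T? ∘ positive) levelSizes-positive ⟨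
    filterᵇ positive (map (levelSize ρ) levels)  ≡⟨ alpha-sublevels ρ k (rank-≤ F) (subst (All _) (sym sublevels≡F) (All.map proj₁ vertices)) ⟨
    alpha (sublevels ρ 0 k)                      ≡⟨ cong alpha sublevels≡F ⟩
    alpha F                                      ≡⟨ shape ⟨
    nonzeros e                                   ≡⟨ nonzeros≡map-support ⟩
    map e support                                ∎
    where
    open ValidFlag valid
    open ≡-Reasoning
    ρ : Fin n → ℕ
    ρ = rank F
    k : ℕ
    k = length F
    levels : List ℕ
    levels = iterate suc 0 (suc k)
    sublevels≡F : sublevels ρ 0 k ≡ F
    sublevels≡F = sublevels-rank F 0 linked
    levelSizes-positive : All (T ∘ positive) (map (levelSize ρ) levels)
    levelSizes-positive = All.map⁺ (All-iterate 0 (suc k) λ m _ m<1+k →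
      let (j , ρj≡m) = rank-attains j₀ F linked vertices m (s≤s⁻¹ m<1+k) in <⇒<ᵇ (countF-positive _ j (≡⇒≡ᵇ _ _ ρj≡m)))

  toFlag-surjective-at : ∀ {F} → ValidFlag F → Fin n → ∃[ w ] ValidColoring w × toFlag w ≡ F
  toFlag-surjective-at {F} valid j₀ = w , record { proper = proper ; fixed = fixed′ ; counts = counts } , toFlag-w≡F
    where
    open ValidFlag valid
    open ≡-Reasoning
    ρ : Fin n → ℕ
    ρ = rank F
    k : ℕ
    k = length F
    sublevels≡F : sublevels ρ 0 k ≡ F
    sublevels≡F = sublevels-rank F 0 linked
    |support|≡1+k : length support ≡ suc k
    |support|≡1+k = begin
      length support                                     ≡⟨ length-map e support ⟨
      length (map e support)                             ≡⟨ cong length (flag-levelSizes valid j₀) ⟨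
      length (map (levelSize ρ) (iterate suc 0 (suc k))) ≡⟨ length-map _ (iterate suc 0 (suc k)) ⟩
      length (iterate suc 0 (suc k))                     ≡⟨ length-iterate suc 0 (suc k) ⟩
      suc k                                              ∎
    d : Fin K
    d with support | |support|≡1+k
    ... | i ∷ _ | _ = i
    w : Vec (Fin K) n
    w = tabulate (λ j → nth support (ρ j) d)
    open Factored w ρ k d |support|≡1+k (Vec.lookup∘tabulate _) (rank-≤ F)
    counts : ∀ i → colorCount w (toℕ i) ≡ e i
    counts = counts-from-levelSizes λ m m≤k →
      map-iterate-≡⁻ (levelSize ρ) _ 0 (suc k) (trans (flag-levelSizes valid j₀) map-e-support) m z≤n (s≤s m≤k)
    fixed′ : ∀ j → lookup w (π ⟨$⟩ʳ j) ≡ lookup w j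
    fixed′ j = begin
      lookup w (π ⟨$⟩ʳ j)                         ≡⟨ Vec.lookup∘tabulate _ (π ⟨$⟩ʳ j) ⟩
      nth support (rank F (π ⟨$⟩ʳ j)) d           ≡⟨ cong (λ r → nth support r d) (rank-permute π F j) ⟨
      nth support (rank (map (actSub g) F) j) d   ≡⟨ cong (λ F′ → nth support (rank F′ j) d) fixed ⟩
      nth support (rank F j) d                    ≡⟨ Vec.lookup∘tabulate _ j ⟨
      lookup w j                                  ∎
    proper : T (properᵇ (color w))
    proper = subst T (sym (trans (proper≡inΣ counts) (cong inΣᵇ sublevels≡F))) inΣ
    toFlag-w≡F : toFlag w ≡ F
    toFlag-w≡F = begin
      sublevels (rankOf w) 0 top   ≡⟨ cong (sublevels (rankOf w) 0) (cong (_∸ 1) |support|≡1+k) ⟩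
      sublevels (rankOf w) 0 k     ≡⟨ sublevels-cong (rankOf w) ρ 0 k (λ j → inj₁ (rankOf-w j)) ⟩
      sublevels ρ 0 k              ≡⟨ sublevels≡F ⟩
      F                            ∎
      where
      rankOf-w : ∀ j → rankOf w j ≡ ρ j
      rankOf-w j = trans (cong (index support) (Vec.lookup∘tabulate _ j))
                         (index-nth support (ρ j) d support-increasing (<|support| (rank-≤ F j)))

  module Empty (n≡0 : n ≡ 0) where

    no-element : Fin n → ⊥
    no-element = ¬Fin0 ∘ subst Fin n≡0

    colorCount≡0 : ∀ w i → colorCount w i ≡ 0
    colorCount≡0 w i = n≤0⇒n≡0 (≤-trans (countF-≤ (λ j → toℕ (lookup w j) ≡ᵇ i)) (≤-reflexive n≡0))

    e≡0⇒support≡[] : (∀ i → e i ≡ 0) → support ≡ []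
    e≡0⇒support≡[] e≡0 = filter-none (T? ∘ positive ∘ e) {xs = allFin K} (All.tabulate λ {i} _ → subst (¬_ ∘ T ∘ positive) (sym (e≡0 i)) λ ())

    support≡[]⇒e≡0 : support ≡ [] → ∀ i → e i ≡ 0
    support≡[]⇒e≡0 support≡[] i with e i in eq
    ... | zero  = refl
    ... | suc _ = case subst (i ∈_) support≡[] (∈-support⁺ i (subst (T ∘ positive) (sym eq) _)) of λ ()

    []-valid : support ≡ [] → ValidFlag []
    []-valid support≡[] = record
      { linked   = []
      ; vertices = []
      ; inΣ      = subst (λ b → T (b ∧ true)) (sym (φ-unit N n≡0 h)) _
      ; fixed    = refl
      ; shape    = trans nonzeros≡map-support (trans (cong (map e) support≡[]) (cong (λ m → filterᵇ positive ((m ∸ 0) ∷ [])) (sym n≡0)))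
      }

    toFlag-valid : ∀ {w} → ValidColoring w → ValidFlag (toFlag w)
    toFlag-valid {w} valid = subst ValidFlag (sym toFlag≡[]) ([]-valid support≡[])
      where
      open ValidColoring valid
      support≡[] : support ≡ []
      support≡[] = e≡0⇒support≡[] λ i → trans (sym (counts i)) (colorCount≡0 w (toℕ i))
      toFlag≡[] : toFlag w ≡ []
      toFlag≡[] = cong (λ s → sublevels (rankOf w) 0 (length s ∸ 1)) support≡[]

    toFlag-surjective : ∀ {F} → ValidFlag F → ∃[ w ] ValidColoring w × toFlag w ≡ F
    toFlag-surjective {F} valid = w , record { proper = proper ; fixed = ⊥-elim ∘ no-element ; counts = counts } , toFlag≡F
      where
      open ValidFlag valid
      no-vertices : ∀ {F} → All IsVertex F → F ≡ []
      no-vertices []                    = refl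
      no-vertices ((0<∣S∣ , ∣S∣<n) ∷ _) = ⊥-elim (<⇒≱ (<-trans 0<∣S∣ ∣S∣<n) (≤-reflexive n≡0))
      F≡[] : F ≡ []
      F≡[] = no-vertices vertices
      support≡[] : support ≡ []
      support≡[] = map≡[] (trans (sym nonzeros≡map-support)
        (trans shape (trans (cong alpha F≡[]) (cong (λ m → filterᵇ positive ((m ∸ 0) ∷ [])) n≡0))))
        where
        map≡[] : ∀ {xs} → map e xs ≡ [] → xs ≡ []
        map≡[] {[]} _ = refl
      w : Vec (Fin K) n
      w = tabulate (⊥-elim ∘ no-element)
      counts : ∀ i → colorCount w (toℕ i) ≡ e i
      counts i = trans (colorCount≡0 w (toℕ i)) (sym (support≡[]⇒e≡0 support≡[] i))
      proper : T (properᵇ (color w))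
      proper = subst (λ vs → T (φC N (map (λ i v → color w v ≡ᵇ i) vs) h)) (sym values≡[]) _
        where
        values≡[] : values (color w) ≡ []
        values≡[] = trans (values≡ (color w) K (λ v → toℕ<n _))
          (cong (map toℕ) (trans (filterᵇ-cong (λ i → cong positive (trans (fiber-color w (toℕ i)) (counts i))) (allFin K)) support≡[]))
      toFlag≡F : toFlag w ≡ F
      toFlag≡F = trans (cong (λ s → sublevels (rankOf w) 0 (length s ∸ 1)) support≡[]) (sym F≡[])

  fin-or-zero : ∀ m → Fin m ⊎ m ≡ 0
  fin-or-zero zero    = inj₂ refl
  fin-or-zero (suc m) = inj₁ Fin.zero

  toFlag-valid : ∀ {w} → ValidColoring w → ValidFlag (toFlag w)
  toFlag-valid valid with fin-or-zero n
  ... | inj₁ j₀  = toFlag-valid-at valid j₀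
  ... | inj₂ n≡0 = Empty.toFlag-valid n≡0 valid

  toFlag-surjective : ∀ {F} → ValidFlag F → ∃[ w ] ValidColoring w × toFlag w ≡ F
  toFlag-surjective valid with fin-or-zero n
  ... | inj₁ j₀  = toFlag-surjective-at valid j₀
  ... | inj₂ n≡0 = Empty.toFlag-surjective n≡0 valid

  Ψcoef≡Fcoef : Ψcoef g K e ≡ Fcoef g K e
  Ψcoef≡Fcoef = countᵇ-≡-by-bijection toFlag isValidColoring isValidFlag (allVecs (allFin K) n) (allSubsetLists n)
    (allVecs-unique (allFin K) (Unique.allFin⁺ K) n) (allSubsetLists-unique n)
    (λ {w} {w'} _ t _ t' → toFlag-injective (validColoring⁻ w t) (validColoring⁻ w' t'))
    (λ {w} _ t → toFlag-into (toFlag-valid (validColoring⁻ w t)))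
    (λ {F} _ t → let (w , valid , toFlag-w≡F) = toFlag-surjective (validFlag⁻ F t) in
                 w , allVecs-complete (allFin K) ∈-allFin w , validColoring⁺ w valid , toFlag-w≡F)
    where
    toFlag-into : ∀ {F} → ValidFlag F → F ∈ allSubsetLists n × T (isValidFlag F)
    toFlag-into {F} valid = allSubsetLists-complete n F (flag-length-≤ F linked vertices) , validFlag⁺ F valid
      where open ValidFlag valid

theorem10 : (Hp : LinHopf) (χ : Character Hp) → BalancedConvex Hp χ →
            (N : FinSet) (h : LinHopf.H Hp N) (𝔊 : Bij N N → Set) →
            (∀ g → 𝔊 g → LinHopf.Hmap Hp g h ≡ h) →
            ∀ g → 𝔊 g →
              Theory.OnSet.IsAut Hp χ N h (Theory.OnSet.Σφ Hp χ N h) (Theory.OnSet.actSub Hp χ N h g) ×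
              (∀ (K : ℕ) (e : Fin K → ℕ) → Theory.OnSet.Ψcoef Hp χ N h g K e ≡ Theory.OnSet.Fcoef Hp χ N h g K e)
theorem10 Hp χ _ N h 𝔊 fixes g g∈𝔊 =
  Automorphism.actSub-isAut Hp χ N h g (fixes g g∈𝔊) ,
  λ K e → Coefficients.Ψcoef≡Fcoef Hp χ N h g K e
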